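{- Define signed graphs $\dot G_r$ recursively by $\dot G_1=K_2$ (a single positive edge) and $\dot G_{r+1}=\dot G_r\ltimes K_2$ for $r\geqslant1$. Then for every $r\geqslant1$, $\dot G_r$ is a signed rectagraph whose eigenvalues are exactly $\pm\sqrt r$.
   Context: A signed graph $\dot G=(G,\sigma)$ consists of a simple graph $G$ and $\sigma:E(G)\to\{1,-1\}$; its adjacency matrix $A_{\dot G}$ is that of $G$ with entries of negative edges replaced by $-1$, and its eigenvalues are those of this matrix. A signed $(0,2)$-graph is a connected signed graph in which any two distinct vertices have $0$ or $2$ common neighbours; a signed rectagraph is a triangle-free one. $\dot G\ltimes K_2$ is the signed graph with adjacency matrix $\begin{bmatrix} A_{\dot G} & I\\ I & -A_{\dot G}\end{bmatrix}$. -}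

module Defs where

open import Data.Nat as ℕ using (ℕ; zero; suc)
open import Data.Integer as ℤ using (ℤ; +_; -_; _*_; _+_)
open import Data.Fin using (Fin; zero; suc; splitAt; punchIn)
open import Data.Fin.Properties using (_≟_)
open import Data.List using (List; []; _∷_; map; filter; length; allFin)
open import Data.List.Relation.Unary.All using (All)
open import Data.Sum using (_⊎_; inj₁; inj₂)
open import Data.Product using (_×_; ∃; ∃-syntax)
open import Relation.Nullary using (¬_; yes; no)
open import Relation.Nullary.Decidable using (_×-dec_; ¬?)
open import Relation.Binary.PropositionalEquality using (_≡_; _≢_)

Mat : ℕ → Set
Mat n = Fin n → Fin n → ℤ

IsSignedGraph : ∀ {n} → Mat n → Set
IsSignedGraph {n} A =
  (∀ i j → A i j ≡ A j i) ×
  (∀ i → A i i ≡ + 0) ×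
  (∀ i j → A i j ≡ + 0 ⊎ A i j ≡ + 1 ⊎ A i j ≡ - + 1)

Adj : ∀ {n} → Mat n → Fin n → Fin n → Set
Adj A i j = A i j ≢ + 0

commonNbrs : ∀ {n} → Mat n → Fin n → Fin n → ℕ
commonNbrs {n} A i j =
  length (filter (λ k → ¬? (A i k ℤ.≟ + 0) ×-dec ¬? (A j k ℤ.≟ + 0)) (allFin n))

data Reach {n} (A : Mat n) : Fin n → Fin n → Set where
  here : ∀ {i} → Reach A i i
  step : ∀ {i k j} → Adj A i k → Reach A k j → Reach A i j

Connected : ∀ {n} → Mat n → Set
Connected {n} A = ∀ (i j : Fin n) → Reach A i j

TriangleFree : ∀ {n} → Mat n → Set
TriangleFree A = ∀ i j k → ¬ (Adj A i j × Adj A j k × Adj A i k)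

IsSigned02Graph : ∀ {n} → Mat n → Set
IsSigned02Graph A =
  IsSignedGraph A × Connected A ×
  (∀ i j → i ≢ j → commonNbrs A i j ≡ 0 ⊎ commonNbrs A i j ≡ 2)

IsSignedRectagraph : ∀ {n} → Mat n → Set
IsSignedRectagraph A = IsSigned02Graph A × TriangleFree A

-- The construction  G ⋉ K₂  with adjacency matrix [[A, I], [I, -A]]

δ : ∀ {n} → Fin n → Fin n → ℤ
δ a b with a ≟ b
... | yes _ = + 1
... | no  _ = + 0

⋉K₂ : ∀ {n} → Mat n → Mat (n ℕ.+ n)
⋉K₂ {n} A i j with splitAt n i | splitAt n j
... | inj₁ a | inj₁ b = A a b
... | inj₁ a | inj₂ b = δ a b
... | inj₂ a | inj₁ b = δ a b
... | inj₂ a | inj₂ b = - A a b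

K₂ : Mat 2
K₂ zero zero = + 0
K₂ zero (suc zero) = + 1
K₂ (suc zero) zero = + 1
K₂ (suc zero) (suc zero) = + 0

-- G_{k+1} has 2^{k+1} vertices  (index shifted: Gr k is \dot G_{k+1})
size : ℕ → ℕ
size zero = 2
size (suc k) = size k ℕ.+ size k

Gr : (k : ℕ) → Mat (size k)
Gr zero = K₂
Gr (suc k) = ⋉K₂ (Gr k)

-- Polynomials over ℤ as coefficient lists (lowest degree first)

Poly : Set
Poly = List ℤ

infixl 6 _+P_
infixl 7 _*P_
infixr 8 _^P_
infix 4 _≈P_ _∣P_

_+P_ : Poly → Poly → Poly
[] +P q = q
(a ∷ p) +P [] = a ∷ p
(a ∷ p) +P (b ∷ q) = (a + b) ∷ (p +P q)

scaleP : ℤ → Poly → Poly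
scaleP c p = map (c *_) p

negP : Poly → Poly
negP = scaleP (- + 1)

_*P_ : Poly → Poly → Poly
[] *P q = []
(a ∷ p) *P q = scaleP a q +P (+ 0 ∷ (p *P q))

_^P_ : Poly → ℕ → Poly
p ^P zero = + 1 ∷ []
p ^P suc m = p *P (p ^P m)

-- equality of polynomials (ignoring trailing zero coefficients)
_≈P_ : Poly → Poly → Set
p ≈P q = All (_≡ + 0) (p +P negP q)

_∣P_ : Poly → Poly → Set
p ∣P q = ∃[ s ] ((p *P s) ≈P q)

sgn : ℕ → ℤ
sgn zero = + 1
sgn (suc zero) = - + 1
sgn (suc (suc m)) = sgn m

toℕ' : ∀ {n} → Fin n → ℕ
toℕ' zero = zero
toℕ' (suc i) = suc (toℕ' i)

sumP : ∀ {n} → (Fin n → Poly) → Poly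
sumP {zero} f = []
sumP {suc n} f = f zero +P sumP (λ i → f (suc i))

detP : ∀ n → (Fin n → Fin n → Poly) → Poly
detP zero M = + 1 ∷ []
detP (suc n) M =
  sumP (λ j → scaleP (sgn (toℕ' j))
                (M zero j *P detP n (λ a b → M (suc a) (punchIn j b))))

charPoly : ∀ {n} → Mat n → Poly
charPoly {n} A = detP n (λ i j → ((δ i j ∷ []) *P (+ 0 ∷ + 1 ∷ [])) +P negP (A i j ∷ []))

x²- : ℕ → Poly
x²- c = - + c ∷ + 0 ∷ + 1 ∷ []

-- "The eigenvalues of A are exactly ±√c": both +√c and -√c are roots of
-- the characteristic polynomial (i.e. x² - c divides it), and it has no
-- other roots (i.e. it divides some power of x² - c).
EigenvaluesExactlyPm√ : ∀ {n} → Mat n → ℕ → Set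
EigenvaluesExactlyPm√ A c =
  (x²- c ∣P charPoly A) × (∃[ m ] (charPoly A ∣P (x²- c ^P m)))

-- Write A for the adjacency matrix of Ġ_r. The block matrix [[A, I], [I, -A]]
-- squares to (A² + I) ⊕ (A² + I), so A² = r I by induction. In x I minus that
-- block matrix, add Σₗ (x I - A) l b times the right-hand column l to each
-- left-hand column b; by (x I + A) (x I - A) = (x² - r) I this leaves
-- [[0, -I], [(x² - r - 1) I, x I + A]], whose determinant is (x² - (r + 1))ⁿ.
-- As the determinant is expansion along the first row, its invariance under such
-- column operations rests on two facts proved by induction on the size: it is
-- linear in each column, and exchanging adjacent columns negates it, so that two
-- equal columns make it vanish. Polynomial identities are checked by evaluation
-- at every natural number, as a polynomial vanishing at all large naturals is zero.
--
-- In G ⋉ K₂ the two copies of G are joined by a perfect matching. So a vertex has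
-- exactly one neighbour in the other copy, which creates no triangle, and two
-- vertices in different copies have the twins of each other as common neighbours
-- when their preimages are adjacent, and none otherwise.

module Submission where

open import Defs
open import Data.Nat using (ℕ; suc)
open import Data.Product using (_×_)

open import Algebra.Bundles using (Monoid)
open import Data.Nat as ℕ using (zero; _≤_; _<_; z≤n; s≤s)
import Data.Nat.Properties as ℕP
open import Data.Integer as ℤ using (ℤ; +_; -_; _*_; _+_; _-_; ∣_∣; +[1+_]; -[1+_])
import Data.Integer.Properties as ℤP
open import Data.Integer.Tactic.RingSolver using (solve-∀)
open import Data.Fin using (Fin; zero; suc; toℕ; fromℕ<; punchIn; punchOut; splitAt; _↑ˡ_; _↑ʳ_)
import Data.Fin.Permutation as Perm
open import Data.Fin.Permutation.Components using (transpose)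
import Data.Fin.Properties as FinP
open import Data.Bool using (Bool; true; false; _∧_; not)
import Data.Bool.Properties as BoolP
open import Data.List using ([]; _∷_; length; filter; tabulate)
open import Data.List.Relation.Unary.All using (All; []; _∷_)
open import Data.Product using (_,_; proj₁; proj₂; ∃-syntax)
open import Relation.Binary.Definitions using (tri<; tri≈; tri>)
open import Data.Empty using (⊥; ⊥-elim)
open import Data.Sum using (_⊎_; inj₁; inj₂)
open import Function using (_∘_; id)
open import Relation.Nullary using (Dec; yes; no; ¬_; does)
open import Relation.Unary using (Pred; Decidable)
open import Relation.Nullary.Decidable using (dec-true; dec-false; ¬?; _×-dec_)
open import Relation.Binary.PropositionalEquality
open ≡-Reasoning

-- Finite sums and the Kronecker delta

module MonoidSum {a ℓ} (M : Monoid a ℓ) where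
  open Monoid M using (Carrier; _≈_; _∙_; ε)
  open import Algebra.Properties.Monoid.Sum M public using (sum; sum-cong-≗)
  private module M = Monoid M

  sum-↑ : ∀ m n (f : Fin (m ℕ.+ n) → Carrier) →
          sum f ≈ sum (λ a → f (a ↑ˡ n)) ∙ sum (λ b → f (m ↑ʳ b))
  sum-↑ zero    n f = M.sym (M.identityˡ _)
  sum-↑ (suc m) n f = M.trans (M.∙-congˡ (sum-↑ m n (f ∘ suc))) (M.sym (M.assoc _ _ _))

  sum-zero : ∀ {n} (f : Fin n → Carrier) → (∀ i → f i ≈ ε) → sum f ≈ ε
  sum-zero {zero}  f f≈ε = M.refl
  sum-zero {suc n} f f≈ε = M.trans (M.∙-cong (f≈ε zero) (sum-zero (f ∘ suc) (f≈ε ∘ suc))) (M.identityˡ ε)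

  sum-single : ∀ {n} (f : Fin n → Carrier) i → (∀ j → j ≢ i → f j ≈ ε) → sum f ≈ f i
  sum-single f zero    f≈ε =
    M.trans (M.∙-congˡ (sum-zero (f ∘ suc) (λ j → f≈ε (suc j) λ ()))) (M.identityʳ _)
  sum-single f (suc i) f≈ε =
    M.trans (M.∙-cong (f≈ε zero λ ()) (sum-single (f ∘ suc) i (λ j j≢i → f≈ε (suc j) (j≢i ∘ FinP.suc-injective))))
            (M.identityˡ _)

open import Algebra.Properties.Semiring.Sum ℤP.+-*-semiring
  using (sum; sum-cong-≗; ∑-distrib-+; *-distribˡ-sum; sum-permute)
open MonoidSum ℤP.+-0-monoid using (sum-↑; sum-single)
module ℕSum = MonoidSum ℕP.+-0-monoid

sum-neg : ∀ {n} (f : Fin n → ℤ) → sum (λ i → - f i) ≡ - sum f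
sum-neg {zero}  f = refl
sum-neg {suc n} f = trans (cong (λ s → - f zero + s) (sum-neg (f ∘ suc))) (sym (ℤP.neg-distrib-+ (f zero) _))

sum-linear : ∀ {n} a b (f g : Fin n → ℤ) → sum (λ i → a * f i + b * g i) ≡ a * sum f + b * sum g
sum-linear a b f g = begin
  sum (λ i → a * f i + b * g i)               ≡⟨ ∑-distrib-+ (λ i → a * f i) (λ i → b * g i) ⟩
  sum (λ i → a * f i) + sum (λ i → b * g i)   ≡⟨ sym (cong₂ _+_ (*-distribˡ-sum a f) (*-distribˡ-sum b g)) ⟩
  a * sum f + b * sum g                       ∎

data ↑-View (m n : ℕ) : Fin (m ℕ.+ n) → Set where
  left  : (a : Fin m) → ↑-View m n (a ↑ˡ n)
  right : (b : Fin n) → ↑-View m n (m ↑ʳ b)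

↑-view : ∀ m n (i : Fin (m ℕ.+ n)) → ↑-View m n i
↑-view zero    n i       = right i
↑-view (suc m) n zero    = left zero
↑-view (suc m) n (suc i) with ↑-view m n i
... | left a  = left (suc a)
... | right b = right b

↑ˡ≢↑ʳ : ∀ {m n} (a : Fin m) (b : Fin n) → a ↑ˡ n ≢ m ↑ʳ b
↑ˡ≢↑ʳ zero    b ()
↑ˡ≢↑ʳ (suc a) b eq = ↑ˡ≢↑ʳ a b (FinP.suc-injective eq)

δ-refl : ∀ {n} (a : Fin n) → δ a a ≡ + 1
δ-refl a with a FinP.≟ a
... | yes _   = refl
... | no  a≢a = ⊥-elim (a≢a refl)

δ-≢ : ∀ {n} {a b : Fin n} → a ≢ b → δ a b ≡ + 0
δ-≢ {a = a} {b} a≢b with a FinP.≟ b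
... | yes a≡b = ⊥-elim (a≢b a≡b)
... | no  _   = refl

δ-sym : ∀ {n} (a b : Fin n) → δ a b ≡ δ b a
δ-sym a b with a FinP.≟ b
... | yes refl = sym (δ-refl a)
... | no  a≢b  = sym (δ-≢ (a≢b ∘ sym))

δ-↑ˡ : ∀ {m} n (a b : Fin m) → δ (a ↑ˡ n) (b ↑ˡ n) ≡ δ a b
δ-↑ˡ n a b with a FinP.≟ b
... | yes refl = δ-refl (a ↑ˡ n)
... | no  a≢b  = δ-≢ (a≢b ∘ FinP.↑ˡ-injective n a b)

δ-↑ʳ : ∀ {m} n (a b : Fin m) → δ (n ↑ʳ a) (n ↑ʳ b) ≡ δ a b
δ-↑ʳ n a b with a FinP.≟ b
... | yes refl = δ-refl (n ↑ʳ a)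
... | no  a≢b  = δ-≢ (a≢b ∘ FinP.↑ʳ-injective n a b)

δ-↑ˡ-↑ʳ : ∀ {m} (a b : Fin m) → δ (a ↑ˡ m) (m ↑ʳ b) ≡ + 0
δ-↑ˡ-↑ʳ a b = δ-≢ (↑ˡ≢↑ʳ a b)

δ-↑ʳ-↑ˡ : ∀ {m} (a b : Fin m) → δ (m ↑ʳ a) (b ↑ˡ m) ≡ + 0
δ-↑ʳ-↑ˡ a b = δ-≢ (↑ˡ≢↑ʳ b a ∘ sym)

sum-δˡ : ∀ {n} (a : Fin n) (g : Fin n → ℤ) → sum (λ l → δ a l * g l) ≡ g a
sum-δˡ a g = begin
  sum (λ l → δ a l * g l) ≡⟨ sum-single _ a (λ l l≢a → cong (_* g l) (δ-≢ (l≢a ∘ sym))) ⟩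
  δ a a * g a             ≡⟨ cong (_* g a) (δ-refl a) ⟩
  + 1 * g a               ≡⟨ ℤP.*-identityˡ (g a) ⟩
  g a                     ∎

sum-δʳ : ∀ {n} (b : Fin n) (g : Fin n → ℤ) → sum (λ l → g l * δ l b) ≡ g b
sum-δʳ b g = trans (sum-cong-≗ λ l → trans (ℤP.*-comm (g l) (δ l b)) (cong (_* g l) (δ-sym l b))) (sum-δˡ b g)

-- Punching in and transposing indices

toℕ-punchIn-< : ∀ {n} (j : Fin (suc n)) (x : Fin n) → toℕ x < toℕ j → toℕ (punchIn j x) ≡ toℕ x
toℕ-punchIn-< (suc j) zero    _         = refl
toℕ-punchIn-< (suc j) (suc x) (s≤s x<j) = cong suc (toℕ-punchIn-< j x x<j)

toℕ-punchIn-≥ : ∀ {n} (j : Fin (suc n)) (x : Fin n) → toℕ j ≤ toℕ x → toℕ (punchIn j x) ≡ suc (toℕ x)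
toℕ-punchIn-≥ zero    x       _         = refl
toℕ-punchIn-≥ (suc j) (suc x) (s≤s j≤x) = cong suc (toℕ-punchIn-≥ j x j≤x)

transpose-matchˡ : ∀ {n} (c c′ : Fin n) → transpose c c′ c ≡ c′
transpose-matchˡ c c′ rewrite dec-true (c FinP.≟ c) refl = refl

transpose-matchʳ : ∀ {n} (c c′ : Fin n) → transpose c c′ c′ ≡ c
transpose-matchʳ c c′ with c′ FinP.≟ c
... | yes refl = refl
... | no _ rewrite dec-true (c′ FinP.≟ c′) refl = refl

transpose-other : ∀ {n} {c c′ k : Fin n} → k ≢ c → k ≢ c′ → transpose c c′ k ≡ k
transpose-other {c = c} {c′} {k} k≢c k≢c′
  rewrite dec-false (k FinP.≟ c) k≢c | dec-false (k FinP.≟ c′) k≢c′ = refl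

transpose-suc : ∀ {n} (c c′ k : Fin n) → transpose (suc c) (suc c′) (suc k) ≡ suc (transpose c c′ k)
transpose-suc c c′ k = Perm.lift₀-transpose c c′ (suc k)

transpose-invariant : ∀ {n} {A : Set} (f : Fin n → A) {c c′} → f c ≡ f c′ → ∀ k → f (transpose c c′ k) ≡ f k
transpose-invariant f {c} {c′} fc≡fc′ k = by-cases (k FinP.≟ c) (k FinP.≟ c′)
  where
  by-cases : Dec (k ≡ c) → Dec (k ≡ c′) → f (transpose c c′ k) ≡ f k
  by-cases (yes k≡c) _ rewrite k≡c = trans (cong f (transpose-matchˡ c c′)) (sym fc≡fc′)
  by-cases (no _) (yes k≡c′) rewrite k≡c′ = trans (cong f (transpose-matchʳ c c′)) fc≡fc′
  by-cases (no k≢c) (no k≢c′) = cong f (transpose-other k≢c k≢c′)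

transpose-punchIn : ∀ {n} {j c c′ : Fin (suc n)} (j≢c : j ≢ c) (j≢c′ : j ≢ c′) (x : Fin n) →
  transpose c c′ (punchIn j x) ≡ punchIn j (transpose (punchOut j≢c) (punchOut j≢c′) x)
transpose-punchIn {j = j} {c} {c′} j≢c j≢c′ x = by-cases (x FinP.≟ pc) (x FinP.≟ pc′)
  where
  pc = punchOut j≢c
  pc′ = punchOut j≢c′
  by-cases : Dec (x ≡ pc) → Dec (x ≡ pc′) → transpose c c′ (punchIn j x) ≡ punchIn j (transpose pc pc′ x)
  by-cases (yes refl) _ = begin
    transpose c c′ (punchIn j pc)   ≡⟨ cong (transpose c c′) (FinP.punchIn-punchOut j≢c) ⟩
    transpose c c′ c                ≡⟨ transpose-matchˡ c c′ ⟩
    c′                              ≡⟨ FinP.punchIn-punchOut j≢c′ ⟨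
    punchIn j pc′                   ≡⟨ cong (punchIn j) (transpose-matchˡ pc pc′) ⟨
    punchIn j (transpose pc pc′ pc) ∎
  by-cases (no _) (yes refl) = begin
    transpose c c′ (punchIn j pc′)   ≡⟨ cong (transpose c c′) (FinP.punchIn-punchOut j≢c′) ⟩
    transpose c c′ c′                ≡⟨ transpose-matchʳ c c′ ⟩
    c                                ≡⟨ FinP.punchIn-punchOut j≢c ⟨
    punchIn j pc                     ≡⟨ cong (punchIn j) (transpose-matchʳ pc pc′) ⟨
    punchIn j (transpose pc pc′ pc′) ∎
  by-cases (no x≢pc) (no x≢pc′) =
    trans (transpose-other (avoids j≢c x≢pc) (avoids j≢c′ x≢pc′)) (cong (punchIn j) (sym (transpose-other x≢pc x≢pc′)))
    where
    avoids : ∀ {d} (j≢d : j ≢ d) → x ≢ punchOut j≢d → punchIn j x ≢ d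
    avoids j≢d x≢pd eq = x≢pd (FinP.punchIn-injective j x _ (trans eq (sym (FinP.punchIn-punchOut j≢d))))

transpose-punchInˡ : ∀ {n} {c c′ : Fin (suc n)} → toℕ c′ ≡ suc (toℕ c) →
                     ∀ x → transpose c c′ (punchIn c x) ≡ punchIn c′ x
transpose-punchInˡ {c = zero} {suc zero} _ zero    = transpose-matchʳ zero (suc zero)
transpose-punchInˡ {c = zero} {suc zero} _ (suc x) = transpose-other {c = zero} {suc zero} (λ ()) (λ ())
transpose-punchInˡ {suc n} {suc c} {suc c′} adj zero    = transpose-other {c = suc c} {suc c′} (λ ()) (λ ())
transpose-punchInˡ {suc n} {suc c} {suc c′} adj (suc x) =
  trans (transpose-suc c c′ (punchIn c x)) (cong suc (transpose-punchInˡ (ℕP.suc-injective adj) x))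

transpose-punchInʳ : ∀ {n} {c c′ : Fin (suc n)} → toℕ c′ ≡ suc (toℕ c) →
                     ∀ x → transpose c c′ (punchIn c′ x) ≡ punchIn c x
transpose-punchInʳ {c = zero} {suc zero} _ zero    = transpose-matchˡ zero (suc zero)
transpose-punchInʳ {c = zero} {suc zero} _ (suc x) = transpose-other {c = zero} {suc zero} (λ ()) (λ ())
transpose-punchInʳ {suc n} {suc c} {suc c′} adj zero    = transpose-other {c = suc c} {suc c′} (λ ()) (λ ())
transpose-punchInʳ {suc n} {suc c} {suc c′} adj (suc x) =
  trans (transpose-suc c c′ (punchIn c′ x)) (cong suc (transpose-punchInʳ (ℕP.suc-injective adj) x))

punchOut-adjacent : ∀ {n} {j c c′ : Fin (suc n)} (j≢c : j ≢ c) (j≢c′ : j ≢ c′) →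
                    toℕ c′ ≡ suc (toℕ c) → toℕ (punchOut j≢c′) ≡ suc (toℕ (punchOut j≢c))
punchOut-adjacent {j = zero} {zero}  j≢c _ _ = ⊥-elim (j≢c refl)
punchOut-adjacent {j = zero} {suc c} {suc c′} _ _ adj = ℕP.suc-injective adj
punchOut-adjacent {suc n} {suc zero} {zero} {suc zero} _ j≢c′ _ = ⊥-elim (j≢c′ refl)
punchOut-adjacent {suc (suc n)} {suc (suc j)} {zero} {suc zero} _ _ _ = refl
punchOut-adjacent {suc n} {suc j} {suc c} {suc c′} j≢c j≢c′ adj =
  cong suc (punchOut-adjacent (j≢c ∘ cong suc) (j≢c′ ∘ cong suc) (ℕP.suc-injective adj))

<⇒gap : ∀ {m n} → m < n → ∃[ g ] n ≡ suc (g ℕ.+ m)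
<⇒gap {m} m<n with ℕP.m≤n⇒∃[o]m+o≡n m<n
... | g , 1+m+g≡n = g , trans (sym 1+m+g≡n) (cong suc (ℕP.+-comm m g))

-- Determinants by expansion along the first row

sgn-suc : ∀ m → sgn (suc m) ≡ - sgn m
sgn-suc zero          = refl
sgn-suc (suc zero)    = refl
sgn-suc (suc (suc m)) = sgn-suc m

sgn² : ∀ m → sgn m * sgn m ≡ + 1
sgn² zero          = refl
sgn² (suc zero)    = refl
sgn² (suc (suc m)) = sgn² m

-sgn^self : ∀ m → (- sgn m) ℤ.^ m ≡ + 1
-sgn^self zero          = refl
-sgn^self (suc zero)    = refl
-sgn^self (suc (suc m)) = begin
  - sgn m * (- sgn m * (- sgn m) ℤ.^ m)   ≡⟨ ring (sgn m) _ ⟩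
  sgn m * sgn m * (- sgn m) ℤ.^ m         ≡⟨ cong₂ _*_ (sgn² m) (-sgn^self m) ⟩
  + 1                                     ∎
  where
  ring : ∀ s x → - s * (- s * x) ≡ s * s * x
  ring = solve-∀

x≡-x⇒x≡0 : ∀ x → x ≡ - x → x ≡ + 0
x≡-x⇒x≡0 (+ zero)  _ = refl
x≡-x⇒x≡0 +[1+ n ] ()
x≡-x⇒x≡0 -[1+ n ] ()

minor : ∀ {n} → Mat (suc n) → Fin (suc n) → Mat n
minor M j a b = M (suc a) (punchIn j b)

det : ∀ {n} → Mat n → ℤ
laplaceTerm : ∀ {n} → Mat (suc n) → Fin (suc n) → ℤ

det {zero}  M = + 1
det {suc n} M = sum (laplaceTerm M)

laplaceTerm M j = sgn (toℕ j) * (M zero j * det (minor M j))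

det-cong : ∀ {n} {M N : Mat n} → (∀ i j → M i j ≡ N i j) → det M ≡ det N
det-cong {zero}  M≗N = refl
det-cong {suc n} M≗N = sum-cong-≗ λ j →
  cong₂ (λ u d → sgn (toℕ j) * (u * d)) (M≗N zero j) (det-cong λ a b → M≗N (suc a) (punchIn j b))

det-single-entry : ∀ {n} (M : Mat (suc n)) j₀ → (∀ j → j ≢ j₀ → M zero j ≡ + 0) → det M ≡ laplaceTerm M j₀
det-single-entry M j₀ row₀ = sum-single (laplaceTerm M) j₀ λ j j≢j₀ → begin
  sgn (toℕ j) * (M zero j * det (minor M j))  ≡⟨ cong (λ u → sgn (toℕ j) * (u * det (minor M j))) (row₀ j j≢j₀) ⟩
  sgn (toℕ j) * (+ 0 * det (minor M j))       ≡⟨ ℤP.*-zeroʳ (sgn (toℕ j)) ⟩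
  + 0                                         ∎

module AdjacentTransposition {n} (M : Mat (suc n)) {c c′ : Fin (suc n)} (adj : toℕ c′ ≡ suc (toℕ c)) where

  Mτ : Mat (suc n)
  Mτ i j = M i (transpose c c′ j)

  sgn-c′ : sgn (toℕ c′) ≡ - sgn (toℕ c)
  sgn-c′ = trans (cong sgn adj) (sgn-suc (toℕ c))

  laplaceTerm-c : laplaceTerm Mτ c ≡ - laplaceTerm M c′
  laplaceTerm-c = begin
    sgn (toℕ c) * (M zero (transpose c c′ c) * det (minor Mτ c))
      ≡⟨ cong₂ (λ k d → sgn (toℕ c) * (M zero k * d)) (transpose-matchˡ c c′)
               (det-cong λ a b → cong (M (suc a)) (transpose-punchInˡ adj b)) ⟩
    sgn (toℕ c) * (M zero c′ * det (minor M c′))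
      ≡⟨ ring (sgn (toℕ c)) (M zero c′) (det (minor M c′)) ⟩
    - (- sgn (toℕ c) * (M zero c′ * det (minor M c′)))
      ≡⟨ cong (λ s → - (s * (M zero c′ * det (minor M c′)))) (sym sgn-c′) ⟩
    - laplaceTerm M c′ ∎
    where
    ring : ∀ s u d → s * (u * d) ≡ - (- s * (u * d))
    ring = solve-∀

  laplaceTerm-c′ : laplaceTerm Mτ c′ ≡ - laplaceTerm M c
  laplaceTerm-c′ = begin
    sgn (toℕ c′) * (M zero (transpose c c′ c′) * det (minor Mτ c′))
      ≡⟨ cong₂ (λ k d → sgn (toℕ c′) * (M zero k * d)) (transpose-matchʳ c c′)
               (det-cong λ a b → cong (M (suc a)) (transpose-punchInʳ adj b)) ⟩
    sgn (toℕ c′) * (M zero c * det (minor M c))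
      ≡⟨ cong (λ s → s * (M zero c * det (minor M c))) sgn-c′ ⟩
    - sgn (toℕ c) * (M zero c * det (minor M c))
      ≡⟨ ℤP.neg-distribˡ-* (sgn (toℕ c)) _ ⟨
    - laplaceTerm M c ∎

  laplaceTerm-other : ∀ {j} (j≢c : j ≢ c) (j≢c′ : j ≢ c′) →
    det (λ a b → minor M j a (transpose (punchOut j≢c) (punchOut j≢c′) b)) ≡ - det (minor M j) →
    laplaceTerm Mτ j ≡ - laplaceTerm M j
  laplaceTerm-other {j} j≢c j≢c′ minor-swapped = begin
    sgn (toℕ j) * (M zero (transpose c c′ j) * det (minor Mτ j))
      ≡⟨ cong₂ (λ k d → sgn (toℕ j) * (M zero k * d)) (transpose-other j≢c j≢c′)
               (det-cong λ a b → cong (M (suc a)) (transpose-punchIn j≢c j≢c′ b)) ⟩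
    sgn (toℕ j) * (M zero j * det (λ a b → minor M j a (transpose (punchOut j≢c) (punchOut j≢c′) b)))
      ≡⟨ cong (λ d → sgn (toℕ j) * (M zero j * d)) minor-swapped ⟩
    sgn (toℕ j) * (M zero j * - det (minor M j))
      ≡⟨ ring (sgn (toℕ j)) (M zero j) (det (minor M j)) ⟩
    - laplaceTerm M j ∎
    where
    ring : ∀ s u d → s * (u * - d) ≡ - (s * (u * d))
    ring = solve-∀

det-transpose-adjacent : ∀ {n} (M : Mat n) {c c′} → toℕ c′ ≡ suc (toℕ c) →
                         det (λ i j → M i (transpose c c′ j)) ≡ - det M
det-transpose-adjacent {suc n} M {c} {c′} adj = begin
  sum (laplaceTerm Mτ)                   ≡⟨ sum-cong-≗ (λ j → by-cases j (j FinP.≟ c) (j FinP.≟ c′)) ⟩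
  sum (-laplaceTerm ∘ transpose c c′)    ≡⟨ sum-permute -laplaceTerm (Perm.transpose c c′) ⟨
  sum -laplaceTerm                       ≡⟨ sum-neg (laplaceTerm M) ⟩
  - det M                                ∎
  where
  open AdjacentTransposition M adj
  -laplaceTerm : Fin (suc n) → ℤ
  -laplaceTerm j = - laplaceTerm M j
  by-cases : ∀ j → Dec (j ≡ c) → Dec (j ≡ c′) → laplaceTerm Mτ j ≡ -laplaceTerm (transpose c c′ j)
  by-cases j (yes refl) _ = trans laplaceTerm-c (cong -laplaceTerm (sym (transpose-matchˡ c c′)))
  by-cases j (no _) (yes refl) = trans laplaceTerm-c′ (cong -laplaceTerm (sym (transpose-matchʳ c c′)))
  by-cases j (no j≢c) (no j≢c′) =
    trans (laplaceTerm-other j≢c j≢c′ (det-transpose-adjacent (minor M j) (punchOut-adjacent j≢c j≢c′ adj)))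
          (cong -laplaceTerm (sym (transpose-other j≢c j≢c′)))

det-equal-columns-gap : ∀ g {n} (M : Mat n) {c c′} → toℕ c′ ≡ suc (g ℕ.+ toℕ c) →
                        (∀ i → M i c ≡ M i c′) → det M ≡ + 0
det-equal-columns-gap zero M {c} {c′} adj c≡c′ = x≡-x⇒x≡0 (det M) (begin
  det M                                  ≡⟨ det-cong (λ i j → transpose-invariant (M i) (c≡c′ i) j) ⟨
  det (λ i j → M i (transpose c c′ j))   ≡⟨ det-transpose-adjacent M adj ⟩
  - det M                                ∎)
det-equal-columns-gap (suc g) {n} M {c} {c′} gap c≡c′ = begin
  det M             ≡⟨ ℤP.neg-involutive (det M) ⟨
  - - det M         ≡⟨ cong -_ (det-transpose-adjacent M adj) ⟨
  - det M″          ≡⟨ cong -_ (det-equal-columns-gap g M″ (FinP.toℕ-fromℕ< c″<n) c≡c″) ⟩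
  - + 0             ∎
  where
  c″<n : suc (g ℕ.+ toℕ c) < n
  c″<n = ℕP.<-trans (subst (suc (g ℕ.+ toℕ c) <_) (sym gap) (ℕP.n<1+n _)) (FinP.toℕ<n c′)
  c″ : Fin n
  c″ = fromℕ< c″<n
  adj : toℕ c′ ≡ suc (toℕ c″)
  adj = trans gap (cong suc (sym (FinP.toℕ-fromℕ< c″<n)))
  M″ : Mat n
  M″ i j = M i (transpose c″ c′ j)
  c≢ : ∀ {d} → toℕ c < toℕ d → c ≢ d
  c≢ c<d = ℕP.<⇒≢ c<d ∘ cong toℕ
  c<c″ : toℕ c < toℕ c″
  c<c″ = subst (toℕ c <_) (sym (FinP.toℕ-fromℕ< c″<n)) (s≤s (ℕP.m≤n+m (toℕ c) g))
  c″<c′ : toℕ c″ < toℕ c′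
  c″<c′ = subst (toℕ c″ <_) (sym adj) (ℕP.n<1+n _)
  c≡c″ : ∀ i → M″ i c ≡ M″ i c″
  c≡c″ i = begin
    M i (transpose c″ c′ c)    ≡⟨ cong (M i) (transpose-other (c≢ c<c″) (c≢ (ℕP.<-trans c<c″ c″<c′))) ⟩
    M i c                      ≡⟨ c≡c′ i ⟩
    M i c′                     ≡⟨ cong (M i) (transpose-matchˡ c″ c′) ⟨
    M i (transpose c″ c′ c″)   ∎

det-equal-columns : ∀ {n} (M : Mat n) {c c′} → c ≢ c′ → (∀ i → M i c ≡ M i c′) → det M ≡ + 0
det-equal-columns M {c} {c′} c≢c′ c≡c′ with ℕP.<-cmp (toℕ c) (toℕ c′)
... | tri< c<c′ _ _ = let g , gap = <⇒gap c<c′ in det-equal-columns-gap g M gap c≡c′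
... | tri≈ _ c≡c′ _ = ⊥-elim (c≢c′ (FinP.toℕ-injective c≡c′))
... | tri> _ _ c′<c = let g , gap = <⇒gap c′<c in det-equal-columns-gap g M gap (sym ∘ c≡c′)

det-linear-column : ∀ {n} c (M Mu Mv : Mat n) a b →
  (∀ i j → j ≢ c → M i j ≡ Mu i j) → (∀ i j → j ≢ c → M i j ≡ Mv i j) →
  (∀ i → M i c ≡ a * Mu i c + b * Mv i c) → det M ≡ a * det Mu + b * det Mv
det-linear-column {suc n} c M Mu Mv a b M≡Mu M≡Mv column-c =
  trans (sum-cong-≗ λ j → by-cases j (j FinP.≟ c)) (sum-linear a b (laplaceTerm Mu) (laplaceTerm Mv))
  where
  at-c : ∀ a b s u v d → s * ((a * u + b * v) * d) ≡ a * (s * (u * d)) + b * (s * (v * d))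
  at-c = solve-∀
  off-c : ∀ a b s m d e → s * (m * (a * d + b * e)) ≡ a * (s * (m * d)) + b * (s * (m * e))
  off-c = solve-∀
  by-cases : ∀ j → Dec (j ≡ c) → laplaceTerm M j ≡ a * laplaceTerm Mu j + b * laplaceTerm Mv j
  by-cases j (yes refl) = begin
    sgn (toℕ j) * (M zero j * det (minor M j))
      ≡⟨ cong (λ u → sgn (toℕ j) * (u * det (minor M j))) (column-c zero) ⟩
    sgn (toℕ j) * ((a * Mu zero j + b * Mv zero j) * det (minor M j))
      ≡⟨ at-c a b (sgn (toℕ j)) (Mu zero j) (Mv zero j) (det (minor M j)) ⟩
    a * (sgn (toℕ j) * (Mu zero j * det (minor M j))) + b * (sgn (toℕ j) * (Mv zero j * det (minor M j)))
      ≡⟨ cong₂ (λ du dv → a * (sgn (toℕ j) * (Mu zero j * du)) + b * (sgn (toℕ j) * (Mv zero j * dv)))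
               (det-cong λ x y → M≡Mu (suc x) (punchIn j y) (FinP.punchInᵢ≢i j y))
               (det-cong λ x y → M≡Mv (suc x) (punchIn j y) (FinP.punchInᵢ≢i j y)) ⟩
    a * laplaceTerm Mu j + b * laplaceTerm Mv j ∎
  by-cases j (no j≢c) = begin
    sgn (toℕ j) * (M zero j * det (minor M j))
      ≡⟨ cong (λ d → sgn (toℕ j) * (M zero j * d)) minor-linear ⟩
    sgn (toℕ j) * (M zero j * (a * det (minor Mu j) + b * det (minor Mv j)))
      ≡⟨ off-c a b (sgn (toℕ j)) (M zero j) (det (minor Mu j)) (det (minor Mv j)) ⟩
    a * (sgn (toℕ j) * (M zero j * det (minor Mu j))) + b * (sgn (toℕ j) * (M zero j * det (minor Mv j)))
      ≡⟨ cong₂ (λ u v → a * (sgn (toℕ j) * (u * det (minor Mu j))) + b * (sgn (toℕ j) * (v * det (minor Mv j))))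
               (M≡Mu zero j j≢c) (M≡Mv zero j j≢c) ⟩
    a * laplaceTerm Mu j + b * laplaceTerm Mv j ∎
    where
    c′ = punchOut j≢c
    punchIn≢c : ∀ y → y ≢ c′ → punchIn j y ≢ c
    punchIn≢c y y≢c′ eq = y≢c′ (FinP.punchIn-injective j y c′ (trans eq (sym (FinP.punchIn-punchOut j≢c))))
    minor-linear : det (minor M j) ≡ a * det (minor Mu j) + b * det (minor Mv j)
    minor-linear = det-linear-column c′ (minor M j) (minor Mu j) (minor Mv j) a b
      (λ x y y≢c′ → M≡Mu (suc x) (punchIn j y) (punchIn≢c y y≢c′))
      (λ x y y≢c′ → M≡Mv (suc x) (punchIn j y) (punchIn≢c y y≢c′))
      (λ x → subst (λ k → M (suc x) k ≡ a * Mu (suc x) k + b * Mv (suc x) k)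
                   (sym (FinP.punchIn-punchOut j≢c)) (column-c (suc x)))

setColumn : ∀ {n} → Mat n → Fin n → (Fin n → ℤ) → Mat n
setColumn M r v i j with j FinP.≟ r
... | yes _ = v i
... | no  _ = M i j

setColumn-≡ : ∀ {n} (M : Mat n) r v i → setColumn M r v i r ≡ v i
setColumn-≡ M r v i with r FinP.≟ r
... | yes _   = refl
... | no  r≢r = ⊥-elim (r≢r refl)

setColumn-≢ : ∀ {n} (M : Mat n) r v i {j} → j ≢ r → setColumn M r v i j ≡ M i j
setColumn-≢ M r v i {j} j≢r with j FinP.≟ r
... | yes j≡r = ⊥-elim (j≢r j≡r)
... | no  _   = refl

det-add-columns : ∀ {n m} (M M′ : Mat n) r (src : Fin m → Fin n) (e : Fin m → ℤ) →
  (∀ l → src l ≢ r) → (∀ i j → j ≢ r → M′ i j ≡ M i j) →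
  (∀ i → M′ i r ≡ M i r + sum (λ l → e l * M i (src l))) → det M′ ≡ det M
det-add-columns {m = zero} M M′ r src e _ M′≡M column-r = det-cong λ i j → by-cases i j (j FinP.≟ r)
  where
  by-cases : ∀ i j → Dec (j ≡ r) → M′ i j ≡ M i j
  by-cases i j (yes refl)  = trans (column-r i) (ℤP.+-identityʳ (M i j))
  by-cases i j (no j≢r)    = M′≡M i j j≢r
det-add-columns {m = suc m} M M′ r src e src≢r M′≡M column-r = begin
  det M′                                      ≡⟨ det-linear-column r M′ M-rest M-src₀ (+ 1) (e zero) ≡-rest ≡-src₀ split-r ⟩
  + 1 * det M-rest + e zero * det M-src₀      ≡⟨ cong₂ (λ d d′ → + 1 * d + e zero * d′) rest-added src₀-repeated ⟩
  + 1 * det M + e zero * + 0                  ≡⟨ ring (det M) (e zero) ⟩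
  det M                                       ∎
  where
  ring : ∀ d e → + 1 * d + e * + 0 ≡ d
  ring = solve-∀
  rest : Fin _ → ℤ
  rest i = M i r + sum (λ l → e (suc l) * M i (src (suc l)))
  M-rest = setColumn M r rest
  M-src₀ = setColumn M r (λ i → M i (src zero))
  ≡-rest : ∀ i j → j ≢ r → M′ i j ≡ M-rest i j
  ≡-rest i j j≢r = trans (M′≡M i j j≢r) (sym (setColumn-≢ M r rest i j≢r))
  ≡-src₀ : ∀ i j → j ≢ r → M′ i j ≡ M-src₀ i j
  ≡-src₀ i j j≢r = trans (M′≡M i j j≢r) (sym (setColumn-≢ M r _ i j≢r))
  regroup : ∀ a b c s → a + (b * c + s) ≡ + 1 * (a + s) + b * c
  regroup = solve-∀
  split-r : ∀ i → M′ i r ≡ + 1 * M-rest i r + e zero * M-src₀ i r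
  split-r i = begin
    M′ i r                                                 ≡⟨ column-r i ⟩
    M i r + (e zero * M i (src zero) + _)                  ≡⟨ regroup (M i r) (e zero) (M i (src zero)) _ ⟩
    + 1 * rest i + e zero * M i (src zero)                 ≡⟨ cong₂ (λ u v → + 1 * u + e zero * v)
                                                                    (sym (setColumn-≡ M r rest i)) (sym (setColumn-≡ M r _ i)) ⟩
    + 1 * M-rest i r + e zero * M-src₀ i r                 ∎
  rest-added : det M-rest ≡ det M
  rest-added = det-add-columns M M-rest r (src ∘ suc) (e ∘ suc) (src≢r ∘ suc)
                 (λ i j j≢r → setColumn-≢ M r rest i j≢r) (setColumn-≡ M r rest)
  src₀-repeated : det M-src₀ ≡ + 0
  src₀-repeated = det-equal-columns M-src₀ (src≢r zero ∘ sym)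
    (λ i → trans (setColumn-≡ M r _ i) (sym (setColumn-≢ M r _ i (src≢r zero))))

module LeadingColumnOperations {N m} (M : Mat N) (src : Fin m → Fin N) (C : Fin N → Fin m → ℤ) where

  addedBelow : ℕ → Mat N
  addedBelow t i j with toℕ j ℕ.<? t
  ... | yes _ = M i j + sum (λ l → C j l * M i (src l))
  ... | no  _ = M i j

  addedBelow-< : ∀ {t} i j → toℕ j < t → addedBelow t i j ≡ M i j + sum (λ l → C j l * M i (src l))
  addedBelow-< {t} i j j<t with toℕ j ℕ.<? t
  ... | yes _   = refl
  ... | no  j≮t = ⊥-elim (j≮t j<t)

  addedBelow-≮ : ∀ {t} i j → ¬ toℕ j < t → addedBelow t i j ≡ M i j
  addedBelow-≮ {t} i j j≮t with toℕ j ℕ.<? t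
  ... | yes j<t = ⊥-elim (j≮t j<t)
  ... | no  _   = refl

  det-addedBelow : ∀ t → t ≤ N → (∀ l → t ≤ toℕ (src l)) → det (addedBelow t) ≡ det M
  det-addedBelow zero    _   _        = det-cong λ i j → addedBelow-≮ {0} i j λ ()
  det-addedBelow (suc t) t<N t<src = trans column-r-added (det-addedBelow t (ℕP.<⇒≤ t<N) (ℕP.<⇒≤ ∘ t<src))
    where
    r : Fin N
    r = fromℕ< t<N
    toℕ-r : toℕ r ≡ t
    toℕ-r = FinP.toℕ-fromℕ< t<N
    src≢r : ∀ l → src l ≢ r
    src≢r l eq = ℕP.<⇒≢ (t<src l) (trans (sym toℕ-r) (cong toℕ (sym eq)))
    src≮t : ∀ l → ¬ toℕ (src l) < t
    src≮t l src<t = ℕP.<-asym src<t (t<src l)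
    others : ∀ i j → j ≢ r → addedBelow (suc t) i j ≡ addedBelow t i j
    others i j j≢r = by-cases (toℕ j ℕ.<? t)
      where
      by-cases : Dec (toℕ j < t) → addedBelow (suc t) i j ≡ addedBelow t i j
      by-cases (yes j<t) = trans (addedBelow-< i j (ℕP.m<n⇒m<1+n j<t)) (sym (addedBelow-< i j j<t))
      by-cases (no  j≮t) = trans (addedBelow-≮ i j j≮1+t) (sym (addedBelow-≮ i j j≮t))
        where
        j≮1+t : ¬ toℕ j < suc t
        j≮1+t j<1+t with ℕP.m≤n⇒m<n∨m≡n (ℕP.≤-pred j<1+t)
        ... | inj₁ j<t = j≮t j<t
        ... | inj₂ j≡t = j≢r (FinP.toℕ-injective (trans j≡t (sym toℕ-r)))
    column-r : ∀ i → addedBelow (suc t) i r ≡ addedBelow t i r + sum (λ l → C r l * addedBelow t i (src l))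
    column-r i = trans (addedBelow-< i r (subst (_< suc t) (sym toℕ-r) (ℕP.n<1+n t)))
      (cong₂ _+_ (sym (addedBelow-≮ i r (ℕP.<-irrefl toℕ-r)))
                 (sum-cong-≗ λ l → cong (C r l *_) (sym (addedBelow-≮ i (src l) (src≮t l)))))
    column-r-added : det (addedBelow (suc t)) ≡ det (addedBelow t)
    column-r-added = det-add-columns (addedBelow t) (addedBelow (suc t)) r src (C r) src≢r others column-r

det-diagonal : ∀ {n} d (M : Mat n) → (∀ i → M i i ≡ d) → (∀ i j → i ≢ j → M i j ≡ + 0) → det M ≡ d ℤ.^ n
det-diagonal {zero}  d M _        _       = refl
det-diagonal {suc n} d M diagonal offDiag = begin
  det M                                ≡⟨ det-single-entry M zero (λ j j≢0 → offDiag zero j (j≢0 ∘ sym)) ⟩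
  + 1 * (M zero zero * det (minor M zero))
    ≡⟨ cong₂ (λ u v → + 1 * (u * v)) (diagonal zero)
             (det-diagonal d (minor M zero) (diagonal ∘ suc) (λ i j i≢j → offDiag (suc i) (suc j) (i≢j ∘ FinP.suc-injective))) ⟩
  + 1 * (d * d ℤ.^ n)                  ≡⟨ ℤP.*-identityˡ _ ⟩
  d ℤ.^ suc n                          ∎

-- In blocks, M = [[0, -I_p], [d I_n, *]].
det-antiblock : ∀ p {n} d (M : Mat (p ℕ.+ n)) →
  (∀ i j → toℕ i < p → toℕ j ≡ n ℕ.+ toℕ i → M i j ≡ - + 1) →
  (∀ i j → toℕ i < p → toℕ j ≢ n ℕ.+ toℕ i → M i j ≡ + 0) →
  (∀ i j → toℕ j < n → toℕ i ≡ p ℕ.+ toℕ j → M i j ≡ d) →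
  (∀ i j → toℕ j < n → p ≤ toℕ i → toℕ i ≢ p ℕ.+ toℕ j → M i j ≡ + 0) →
  det M ≡ (- sgn n) ℤ.^ p * d ℤ.^ n
det-antiblock zero {n} d M _ _ diagonal offDiag = begin
  det M                   ≡⟨ det-diagonal d M (λ i → diagonal i i (FinP.toℕ<n i) refl)
                               (λ i j i≢j → offDiag i j (FinP.toℕ<n j) z≤n (i≢j ∘ FinP.toℕ-injective)) ⟩
  d ℤ.^ n                 ≡⟨ ℤP.*-identityˡ _ ⟨
  + 1 * d ℤ.^ n           ∎
det-antiblock (suc p) {n} d M top-1 top-0 diagonal offDiag = begin
  det M                                               ≡⟨ det-single-entry M j₀ row₀ ⟩
  sgn (toℕ j₀) * (M zero j₀ * det (minor M j₀))
    ≡⟨ cong₂ (λ s u → s * (u * det (minor M j₀))) (cong sgn toℕ-j₀) (top-1 zero j₀ (s≤s z≤n) (trans toℕ-j₀ (sym (ℕP.+-identityʳ n)))) ⟩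
  sgn n * (- + 1 * det (minor M j₀))                  ≡⟨ cong (λ x → sgn n * (- + 1 * x)) minor-shape ⟩
  sgn n * (- + 1 * ((- sgn n) ℤ.^ p * d ℤ.^ n))       ≡⟨ ring (sgn n) _ _ ⟩
  (- sgn n) ℤ.^ suc p * d ℤ.^ n                       ∎
  where
  ring : ∀ s x y → s * (- + 1 * (x * y)) ≡ - s * x * y
  ring = solve-∀
  n<1+p+n : n < suc p ℕ.+ n
  n<1+p+n = s≤s (ℕP.m≤n+m n p)
  j₀ = fromℕ< n<1+p+n
  toℕ-j₀ : toℕ j₀ ≡ n
  toℕ-j₀ = FinP.toℕ-fromℕ< n<1+p+n
  row₀ : ∀ j → j ≢ j₀ → M zero j ≡ + 0
  row₀ j j≢j₀ = top-0 zero j (s≤s z≤n) (λ eq → j≢j₀ (FinP.toℕ-injective (trans eq (trans (ℕP.+-identityʳ n) (sym toℕ-j₀)))))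
  punchIn-< : ∀ b → toℕ b < n → toℕ (punchIn j₀ b) ≡ toℕ b
  punchIn-< b b<n = toℕ-punchIn-< j₀ b (subst (toℕ b <_) (sym toℕ-j₀) b<n)
  punchIn-≥ : ∀ b → n ≤ toℕ b → toℕ (punchIn j₀ b) ≡ suc (toℕ b)
  punchIn-≥ b n≤b = toℕ-punchIn-≥ j₀ b (subst (_≤ toℕ b) (sym toℕ-j₀) n≤b)
  punchIn-avoids : ∀ i b → toℕ b ≢ n ℕ.+ toℕ i → toℕ (punchIn j₀ b) ≢ n ℕ.+ suc (toℕ i)
  punchIn-avoids i b b≢n+i eq with toℕ b ℕ.<? n
  ... | yes b<n = ℕP.<⇒≱ b<n (subst (n ≤_) (trans (sym eq) (punchIn-< b b<n)) (ℕP.m≤m+n n _))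
  ... | no  b≮n = b≢n+i (ℕP.suc-injective (trans (sym (punchIn-≥ b (ℕP.≮⇒≥ b≮n))) (trans eq (ℕP.+-suc n _))))
  minor-shape : det (minor M j₀) ≡ (- sgn n) ℤ.^ p * d ℤ.^ n
  minor-shape = det-antiblock p d (minor M j₀)
    (λ i b i<p b≡n+i → top-1 (suc i) (punchIn j₀ b) (s≤s i<p)
       (trans (punchIn-≥ b (subst (n ≤_) (sym b≡n+i) (ℕP.m≤m+n n _))) (trans (cong suc b≡n+i) (sym (ℕP.+-suc n _)))))
    (λ i b i<p b≢n+i → top-0 (suc i) (punchIn j₀ b) (s≤s i<p) (punchIn-avoids i b b≢n+i))
    (λ i b b<n i≡p+b → diagonal (suc i) (punchIn j₀ b) (subst (_< n) (sym (punchIn-< b b<n)) b<n)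
       (trans (cong suc i≡p+b) (cong (suc p ℕ.+_) (sym (punchIn-< b b<n)))))
    (λ i b b<n p≤i i≢p+b → offDiag (suc i) (punchIn j₀ b) (subst (_< n) (sym (punchIn-< b b<n)) b<n) (s≤s p≤i)
       (λ eq → i≢p+b (ℕP.suc-injective (trans eq (cong (suc p ℕ.+_) (punchIn-< b b<n))))))

module BlockDeterminant {n} (T U : Mat n) (q : ℤ) (UT≡qI : ∀ a b → sum (λ l → U a l * T l b) ≡ q * δ a b)
  (X : Mat (n ℕ.+ n))
  (X-↑ˡ↑ˡ : ∀ a b → X (a ↑ˡ n) (b ↑ˡ n) ≡ T a b)
  (X-↑ˡ↑ʳ : ∀ a b → X (a ↑ˡ n) (n ↑ʳ b) ≡ - δ a b)
  (X-↑ʳ↑ˡ : ∀ a b → X (n ↑ʳ a) (b ↑ˡ n) ≡ - δ a b)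
  (X-↑ʳ↑ʳ : ∀ a b → X (n ↑ʳ a) (n ↑ʳ b) ≡ U a b) where

  coefficient : Fin (n ℕ.+ n) → Fin n → ℤ
  coefficient j l with splitAt n j
  ... | inj₁ b = T l b
  ... | inj₂ _ = + 0

  coefficient-↑ˡ : ∀ b l → coefficient (b ↑ˡ n) l ≡ T l b
  coefficient-↑ˡ b l rewrite FinP.splitAt-↑ˡ n b n = refl

  open LeadingColumnOperations X (n ↑ʳ_) coefficient

  -- Adding Σₗ T l b · (column n ↑ʳ l) to each left column b clears the
  -- top-left block and turns the bottom-left one into U T - I = (q - 1) I.
  Y : Mat (n ℕ.+ n)
  Y = addedBelow n

  n≤↑ʳ : ∀ (b : Fin n) → n ≤ toℕ (n ↑ʳ b)
  n≤↑ʳ b = subst (n ≤_) (sym (FinP.toℕ-↑ʳ n b)) (ℕP.m≤m+n n (toℕ b))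

  ↑ˡ<n : ∀ (b : Fin n) → toℕ (b ↑ˡ n) < n
  ↑ˡ<n b = subst (_< n) (sym (FinP.toℕ-↑ˡ b n)) (FinP.toℕ<n b)

  det-Y : det Y ≡ det X
  det-Y = det-addedBelow n (ℕP.m≤m+n n n) n≤↑ʳ

  Y-↑ˡ : ∀ i b → Y i (b ↑ˡ n) ≡ X i (b ↑ˡ n) + sum (λ l → T l b * X i (n ↑ʳ l))
  Y-↑ˡ i b = trans (addedBelow-< i (b ↑ˡ n) (↑ˡ<n b))
                   (cong (λ s → X i (b ↑ˡ n) + s) (sum-cong-≗ λ l → cong (_* X i (n ↑ʳ l)) (coefficient-↑ˡ b l)))

  Y-↑ʳ : ∀ i b → Y i (n ↑ʳ b) ≡ X i (n ↑ʳ b)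
  Y-↑ʳ i b = addedBelow-≮ i (n ↑ʳ b) (ℕP.≤⇒≯ (n≤↑ʳ b))

  Y-↑ˡ↑ˡ : ∀ a b → Y (a ↑ˡ n) (b ↑ˡ n) ≡ + 0
  Y-↑ˡ↑ˡ a b = begin
    Y (a ↑ˡ n) (b ↑ˡ n)                                      ≡⟨ Y-↑ˡ (a ↑ˡ n) b ⟩
    X (a ↑ˡ n) (b ↑ˡ n) + sum (λ l → T l b * X (a ↑ˡ n) (n ↑ʳ l))
      ≡⟨ cong₂ _+_ (X-↑ˡ↑ˡ a b) (sum-cong-≗ λ l → trans (cong (T l b *_) (X-↑ˡ↑ʳ a l)) (ring (T l b) (δ a l))) ⟩
    T a b + sum (λ l → - (δ a l * T l b))
      ≡⟨ cong (λ s → T a b + s) (trans (sum-neg (λ l → δ a l * T l b)) (cong -_ (sum-δˡ a (λ l → T l b)))) ⟩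
    T a b - T a b                                            ≡⟨ ℤP.+-inverseʳ (T a b) ⟩
    + 0                                                      ∎
    where
    ring : ∀ t d → t * - d ≡ - (d * t)
    ring = solve-∀

  Y-↑ʳ↑ˡ : ∀ a b → Y (n ↑ʳ a) (b ↑ˡ n) ≡ (q - + 1) * δ a b
  Y-↑ʳ↑ˡ a b = begin
    Y (n ↑ʳ a) (b ↑ˡ n)                                      ≡⟨ Y-↑ˡ (n ↑ʳ a) b ⟩
    X (n ↑ʳ a) (b ↑ˡ n) + sum (λ l → T l b * X (n ↑ʳ a) (n ↑ʳ l))
      ≡⟨ cong₂ _+_ (X-↑ʳ↑ˡ a b) (sum-cong-≗ λ l → trans (cong (T l b *_) (X-↑ʳ↑ʳ a l)) (ℤP.*-comm (T l b) (U a l))) ⟩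
    - δ a b + sum (λ l → U a l * T l b)                      ≡⟨ cong (λ s → - δ a b + s) (UT≡qI a b) ⟩
    - δ a b + q * δ a b                                      ≡⟨ ring q (δ a b) ⟩
    (q - + 1) * δ a b                                        ∎
    where
    ring : ∀ q d → - d + q * d ≡ (q - + 1) * d
    ring = solve-∀

  ↑ʳ≡n+↑ˡ⇒≡ : ∀ (a b : Fin n) → toℕ (n ↑ʳ b) ≡ n ℕ.+ toℕ (a ↑ˡ n) → b ≡ a
  ↑ʳ≡n+↑ˡ⇒≡ a b eq = FinP.toℕ-injective
    (ℕP.+-cancelˡ-≡ n _ _ (trans (sym (FinP.toℕ-↑ʳ n b)) (trans eq (cong (n ℕ.+_) (FinP.toℕ-↑ˡ a n)))))

  top-1 : ∀ i j → toℕ i < n → toℕ j ≡ n ℕ.+ toℕ i → Y i j ≡ - + 1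
  top-1 i j i<n j≡n+i with ↑-view n n i | ↑-view n n j
  ... | right a | _       = ⊥-elim (ℕP.≤⇒≯ (n≤↑ʳ a) i<n)
  ... | left a  | left b  = ⊥-elim (ℕP.≤⇒≯ (subst (n ≤_) (sym j≡n+i) (ℕP.m≤m+n n _)) (↑ˡ<n b))
  ... | left a  | right b rewrite ↑ʳ≡n+↑ˡ⇒≡ a b j≡n+i =
    trans (Y-↑ʳ (a ↑ˡ n) a) (trans (X-↑ˡ↑ʳ a a) (cong -_ (δ-refl a)))

  top-0 : ∀ i j → toℕ i < n → toℕ j ≢ n ℕ.+ toℕ i → Y i j ≡ + 0
  top-0 i j i<n j≢n+i with ↑-view n n i | ↑-view n n j
  ... | right a | _       = ⊥-elim (ℕP.≤⇒≯ (n≤↑ʳ a) i<n)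
  ... | left a  | left b  = Y-↑ˡ↑ˡ a b
  ... | left a  | right b = trans (Y-↑ʳ (a ↑ˡ n) b) (trans (X-↑ˡ↑ʳ a b) (cong -_ (δ-≢ a≢b)))
    where
    a≢b : a ≢ b
    a≢b a≡b = j≢n+i (trans (FinP.toℕ-↑ʳ n b) (cong (n ℕ.+_) (trans (cong toℕ (sym a≡b)) (sym (FinP.toℕ-↑ˡ a n)))))

  diagonal : ∀ i j → toℕ j < n → toℕ i ≡ n ℕ.+ toℕ j → Y i j ≡ q - + 1
  diagonal i j j<n i≡n+j with ↑-view n n i | ↑-view n n j
  ... | _       | right b = ⊥-elim (ℕP.≤⇒≯ (n≤↑ʳ b) j<n)
  ... | left a  | left b  = ⊥-elim (ℕP.≤⇒≯ (subst (n ≤_) (sym i≡n+j) (ℕP.m≤m+n n _)) (↑ˡ<n a))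
  ... | right a | left b rewrite ↑ʳ≡n+↑ˡ⇒≡ b a i≡n+j =
    trans (Y-↑ʳ↑ˡ b b) (trans (cong ((q - + 1) *_) (δ-refl b)) (ℤP.*-identityʳ _))

  offDiagonal : ∀ i j → toℕ j < n → n ≤ toℕ i → toℕ i ≢ n ℕ.+ toℕ j → Y i j ≡ + 0
  offDiagonal i j j<n n≤i i≢n+j with ↑-view n n i | ↑-view n n j
  ... | _       | right b = ⊥-elim (ℕP.≤⇒≯ (n≤↑ʳ b) j<n)
  ... | left a  | left b  = Y-↑ˡ↑ˡ a b
  ... | right a | left b  = trans (Y-↑ʳ↑ˡ a b) (trans (cong ((q - + 1) *_) (δ-≢ a≢b)) (ℤP.*-zeroʳ (q - + 1)))
    where
    a≢b : a ≢ b
    a≢b a≡b = i≢n+j (trans (FinP.toℕ-↑ʳ n a) (cong (n ℕ.+_) (trans (cong toℕ a≡b) (sym (FinP.toℕ-↑ˡ b n)))))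

  det-block : det X ≡ (q - + 1) ℤ.^ n
  det-block = begin
    det X                                   ≡⟨ det-Y ⟨
    det Y                                   ≡⟨ det-antiblock n (q - + 1) Y top-1 top-0 diagonal offDiagonal ⟩
    (- sgn n) ℤ.^ n * (q - + 1) ℤ.^ n       ≡⟨ cong (_* (q - + 1) ℤ.^ n) (-sgn^self n) ⟩
    + 1 * (q - + 1) ℤ.^ n                   ≡⟨ ℤP.*-identityˡ _ ⟩
    (q - + 1) ℤ.^ n                         ∎

charMat : ∀ {n} → Mat n → ℤ → Mat n
charMat A x i j = δ i j * x - A i j

-- Evaluating integer polynomials

eval : Poly → ℤ → ℤ
eval []      x = + 0
eval (a ∷ p) x = a + x * eval p x

eval-one : ∀ x → eval (+ 1 ∷ []) x ≡ + 1
eval-one x = trans (cong (λ t → + 1 + t) (ℤP.*-zeroʳ x)) (ℤP.+-identityʳ (+ 1))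

eval-+P : ∀ p q x → eval (p +P q) x ≡ eval p x + eval q x
eval-+P []      q       x = sym (ℤP.+-identityˡ _)
eval-+P (a ∷ p) []      x = sym (ℤP.+-identityʳ _)
eval-+P (a ∷ p) (b ∷ q) x rewrite eval-+P p q x = ring a b (eval p x) (eval q x) x
  where
  ring : ∀ a b u v x → a + b + x * (u + v) ≡ a + x * u + (b + x * v)
  ring = solve-∀

eval-scaleP : ∀ c p x → eval (scaleP c p) x ≡ c * eval p x
eval-scaleP c []      x = sym (ℤP.*-zeroʳ c)
eval-scaleP c (a ∷ p) x rewrite eval-scaleP c p x = ring c a (eval p x) x
  where
  ring : ∀ c a u x → c * a + x * (c * u) ≡ c * (a + x * u)
  ring = solve-∀

eval-negP : ∀ p x → eval (negP p) x ≡ - eval p x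
eval-negP p x = trans (eval-scaleP (- + 1) p x) (ℤP.-1*i≡-i (eval p x))

eval-*P : ∀ p q x → eval (p *P q) x ≡ eval p x * eval q x
eval-*P []      q x = refl
eval-*P (a ∷ p) q x
  rewrite eval-+P (scaleP a q) (+ 0 ∷ (p *P q)) x | eval-scaleP a q x | eval-*P p q x =
    ring a (eval p x) (eval q x) x
  where
  ring : ∀ a u v x → a * v + (+ 0 + x * (u * v)) ≡ (a + x * u) * v
  ring = solve-∀

eval-^P : ∀ p m x → eval (p ^P m) x ≡ eval p x ℤ.^ m
eval-^P p zero    x = eval-one x
eval-^P p (suc m) x rewrite eval-*P p (p ^P m) x | eval-^P p m x = refl

eval-sumP : ∀ {n} (f : Fin n → Poly) x → eval (sumP f) x ≡ sum (λ i → eval (f i) x)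
eval-sumP {zero}  f x = refl
eval-sumP {suc n} f x
  rewrite eval-+P (f zero) (sumP (f ∘ suc)) x | eval-sumP (f ∘ suc) x = refl

eval-zeros : ∀ p x → All (_≡ + 0) p → eval p x ≡ + 0
eval-zeros []      x []           = refl
eval-zeros (a ∷ p) x (refl ∷ p≡0) rewrite eval-zeros p x p≡0 | ℤP.*-zeroʳ x = refl

a+b≡0⇒a≡-b : ∀ a b → a + b ≡ + 0 → a ≡ - b
a+b≡0⇒a≡-b a b a+b≡0 = begin
  a           ≡⟨ ring a b ⟩
  a + b - b   ≡⟨ cong (_- b) a+b≡0 ⟩
  + 0 - b     ≡⟨ ℤP.+-identityˡ (- b) ⟩
  - b         ∎
  where
  ring : ∀ a b → a ≡ a + b - b
  ring = solve-∀

vanishing⇒zeros : ∀ p N → (∀ x → N ≤ x → eval p (+ x) ≡ + 0) → All (_≡ + 0) p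
vanishing⇒zeros []      N _      = []
vanishing⇒zeros (a ∷ p) N vanish = a≡0 ∷ p≡0
  where
  N′ = N ℕ.+ suc ∣ a ∣

  -- for x > ∣ a ∣ the equation a = - x · p(x) leaves p(x) = 0 as the only option
  p-vanish : ∀ x → N′ ≤ x → eval p (+ x) ≡ + 0
  p-vanish x N′≤x with ∣ eval p (+ x) ∣ in ∣px∣≡
  ... | zero  = ℤP.∣i∣≡0⇒i≡0 ∣px∣≡
  ... | suc k = ⊥-elim (ℕP.<⇒≱ ∣a∣<x (subst (x ≤_) (sym ∣a∣≡) (ℕP.m≤m*n x (suc k))))
    where
    ∣a∣<x : ∣ a ∣ < x
    ∣a∣<x = ℕP.<-≤-trans (ℕP.m≤n+m (suc ∣ a ∣) N) N′≤x
    ∣a∣≡ : ∣ a ∣ ≡ x ℕ.* suc k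
    ∣a∣≡ = begin
      ∣ a ∣                      ≡⟨ cong ∣_∣ (a+b≡0⇒a≡-b a _ (vanish x (ℕP.≤-trans (ℕP.m≤m+n N _) N′≤x))) ⟩
      ∣ - (+ x * eval p (+ x)) ∣ ≡⟨ ℤP.∣-i∣≡∣i∣ (+ x * eval p (+ x)) ⟩
      ∣ + x * eval p (+ x) ∣     ≡⟨ ℤP.abs-* (+ x) _ ⟩
      x ℕ.* ∣ eval p (+ x) ∣     ≡⟨ cong (x ℕ.*_) ∣px∣≡ ⟩
      x ℕ.* suc k                ∎

  p≡0 : All (_≡ + 0) p
  p≡0 = vanishing⇒zeros p N′ p-vanish

  a≡0 : a ≡ + 0
  a≡0 = begin
    a                      ≡⟨ sym (ℤP.+-identityʳ a) ⟩
    a + + 0                ≡⟨ cong (λ t → a + t) (sym (ℤP.*-zeroʳ (+ N))) ⟩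
    a + + N * + 0          ≡⟨ cong (λ t → a + + N * t) (sym (eval-zeros p (+ N) p≡0)) ⟩
    a + + N * eval p (+ N) ≡⟨ vanish N ℕP.≤-refl ⟩
    + 0                    ∎

eval≗⇒≈P : ∀ p q → (∀ x → eval p (+ x) ≡ eval q (+ x)) → p ≈P q
eval≗⇒≈P p q p≗q = vanishing⇒zeros (p +P negP q) 0 λ x _ → begin
  eval (p +P negP q) (+ x)              ≡⟨ eval-+P p (negP q) (+ x) ⟩
  eval p (+ x) + eval (negP q) (+ x)    ≡⟨ cong₂ _+_ (p≗q x) (eval-negP q (+ x)) ⟩
  eval q (+ x) - eval q (+ x)           ≡⟨ ℤP.+-inverseʳ (eval q (+ x)) ⟩
  + 0                                   ∎

toℕ′≡toℕ : ∀ {n} (i : Fin n) → toℕ' i ≡ toℕ i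
toℕ′≡toℕ zero    = refl
toℕ′≡toℕ (suc i) = cong suc (toℕ′≡toℕ i)

eval-detP : ∀ n (M : Fin n → Fin n → Poly) x → eval (detP n M) x ≡ det (λ i j → eval (M i j) x)
eval-detP zero    M x = eval-one x
eval-detP (suc n) M x = trans (eval-sumP (λ j → scaleP (sgn (toℕ' j)) (M zero j *P minorP j)) x) (sum-cong-≗ λ j → begin
  eval (scaleP (sgn (toℕ' j)) (M zero j *P minorP j)) x
    ≡⟨ eval-scaleP (sgn (toℕ' j)) (M zero j *P minorP j) x ⟩
  sgn (toℕ' j) * eval (M zero j *P minorP j) x
    ≡⟨ cong₂ _*_ (cong sgn (toℕ′≡toℕ j)) (eval-*P (M zero j) (minorP j) x) ⟩
  sgn (toℕ j) * (eval (M zero j) x * eval (minorP j) x)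
    ≡⟨ cong (λ d → sgn (toℕ j) * (eval (M zero j) x * d)) (eval-detP n (λ a b → M (suc a) (punchIn j b)) x) ⟩
  laplaceTerm (λ a b → eval (M a b) x) j ∎)
  where
  minorP : Fin (suc n) → Poly
  minorP j = detP n (λ a b → M (suc a) (punchIn j b))

eval-charPoly : ∀ {n} (A : Mat n) x → eval (charPoly A) x ≡ det (charMat A x)
eval-charPoly {n} A x = trans (eval-detP n _ x) (det-cong λ i j → entry (δ i j) (A i j))
  where
  ring : ∀ d a x → (d + x * + 0) * (+ 0 + x * (+ 1 + x * + 0)) + - (a + x * + 0) ≡ d * x - a
  ring = solve-∀
  entry : ∀ d a → eval (((d ∷ []) *P (+ 0 ∷ + 1 ∷ [])) +P negP (a ∷ [])) x ≡ d * x - a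
  entry d a = begin
    eval (((d ∷ []) *P (+ 0 ∷ + 1 ∷ [])) +P negP (a ∷ [])) x
      ≡⟨ eval-+P ((d ∷ []) *P (+ 0 ∷ + 1 ∷ [])) (negP (a ∷ [])) x ⟩
    eval ((d ∷ []) *P (+ 0 ∷ + 1 ∷ [])) x + eval (negP (a ∷ [])) x
      ≡⟨ cong₂ _+_ (eval-*P (d ∷ []) (+ 0 ∷ + 1 ∷ []) x) (eval-negP (a ∷ []) x) ⟩
    eval (d ∷ []) x * eval (+ 0 ∷ + 1 ∷ []) x - eval (a ∷ []) x
      ≡⟨ ring d a x ⟩
    d * x - a ∎

eval-x²- : ∀ c x → eval (x²- c) x ≡ x * x - + c
eval-x²- c x = ring (+ c) x
  where
  ring : ∀ c x → - c + x * (+ 0 + x * (+ 1 + x * + 0)) ≡ x * x - c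
  ring = solve-∀

det[xI-A]≡[x²-c]^e⇒±√c : ∀ {n} (A : Mat n) c e → 0 < e →
                (∀ x → det (charMat A (+ x)) ≡ (+ x * + x - + c) ℤ.^ e) → EigenvaluesExactlyPm√ A c
det[xI-A]≡[x²-c]^e⇒±√c A c (suc h) _ char≡ =
  (x²- c ^P h , eval≗⇒≈P (x²- c *P x²- c ^P h) (charPoly A) λ x → begin
    eval (x²- c *P x²- c ^P h) (+ x)           ≡⟨ eval-*P (x²- c) (x²- c ^P h) (+ x) ⟩
    eval (x²- c) (+ x) * eval (x²- c ^P h) (+ x) ≡⟨ cong₂ _*_ (eval-x²- c (+ x)) (eval-^P (x²- c) h (+ x)) ⟩
    (+ x * + x - + c) * eval (x²- c) (+ x) ℤ.^ h  ≡⟨ cong (λ y → (+ x * + x - + c) * y ℤ.^ h) (eval-x²- c (+ x)) ⟩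
    (+ x * + x - + c) ℤ.^ suc h                 ≡⟨ char≡ x ⟨
    det (charMat A (+ x))                       ≡⟨ eval-charPoly A (+ x) ⟨
    eval (charPoly A) (+ x)                     ∎)
  , (suc h , (+ 1 ∷ []) , eval≗⇒≈P (charPoly A *P (+ 1 ∷ [])) (x²- c ^P suc h) λ x → begin
    eval (charPoly A *P (+ 1 ∷ [])) (+ x)       ≡⟨ eval-*P (charPoly A) (+ 1 ∷ []) (+ x) ⟩
    eval (charPoly A) (+ x) * eval (+ 1 ∷ []) (+ x) ≡⟨ cong₂ _*_ (eval-charPoly A (+ x)) (eval-one (+ x)) ⟩
    det (charMat A (+ x)) * + 1                 ≡⟨ ℤP.*-identityʳ _ ⟩
    det (charMat A (+ x))                       ≡⟨ char≡ x ⟩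
    (+ x * + x - + c) ℤ.^ suc h                 ≡⟨ cong (ℤ._^ suc h) (eval-x²- c (+ x)) ⟨
    eval (x²- c) (+ x) ℤ.^ suc h                ≡⟨ eval-^P (x²- c) (suc h) (+ x) ⟨
    eval (x²- c ^P suc h) (+ x)                 ∎)

-- The spectrum of G ⋉ K₂

module _ {n} (A : Mat n) (a b : Fin n) where
  ⋉K₂-↑ˡ↑ˡ : ⋉K₂ A (a ↑ˡ n) (b ↑ˡ n) ≡ A a b
  ⋉K₂-↑ˡ↑ˡ rewrite FinP.splitAt-↑ˡ n a n | FinP.splitAt-↑ˡ n b n = refl

  ⋉K₂-↑ˡ↑ʳ : ⋉K₂ A (a ↑ˡ n) (n ↑ʳ b) ≡ δ a b
  ⋉K₂-↑ˡ↑ʳ rewrite FinP.splitAt-↑ˡ n a n | FinP.splitAt-↑ʳ n n b = refl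

  ⋉K₂-↑ʳ↑ˡ : ⋉K₂ A (n ↑ʳ a) (b ↑ˡ n) ≡ δ a b
  ⋉K₂-↑ʳ↑ˡ rewrite FinP.splitAt-↑ʳ n n a | FinP.splitAt-↑ˡ n b n = refl

  ⋉K₂-↑ʳ↑ʳ : ⋉K₂ A (n ↑ʳ a) (n ↑ʳ b) ≡ - A a b
  ⋉K₂-↑ʳ↑ʳ rewrite FinP.splitAt-↑ʳ n n a | FinP.splitAt-↑ʳ n n b = refl

SquareIsScalar : ∀ {n} → Mat n → ℤ → Set
SquareIsScalar A c = ∀ a b → sum (λ l → A a l * A l b) ≡ c * δ a b

module _ {n} {A : Mat n} {c} (A²≡cI : SquareIsScalar A c) where
  private
    B = ⋉K₂ A

  ⋉K₂-square-↑ˡ↑ˡ : ∀ a b → sum (λ l → B (a ↑ˡ n) l * B l (b ↑ˡ n)) ≡ (+ 1 + c) * δ (a ↑ˡ n) (b ↑ˡ n)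
  ⋉K₂-square-↑ˡ↑ˡ a b = begin
    sum (λ l → B (a ↑ˡ n) l * B l (b ↑ˡ n))
      ≡⟨ sum-↑ n n _ ⟩
    sum (λ l → B (a ↑ˡ n) (l ↑ˡ n) * B (l ↑ˡ n) (b ↑ˡ n)) + sum (λ l → B (a ↑ˡ n) (n ↑ʳ l) * B (n ↑ʳ l) (b ↑ˡ n))
      ≡⟨ cong₂ _+_ (trans (sum-cong-≗ λ l → cong₂ _*_ (⋉K₂-↑ˡ↑ˡ A a l) (⋉K₂-↑ˡ↑ˡ A l b)) (A²≡cI a b))
                   (trans (sum-cong-≗ λ l → cong₂ _*_ (⋉K₂-↑ˡ↑ʳ A a l) (⋉K₂-↑ʳ↑ˡ A l b)) (sum-δˡ a (λ l → δ l b))) ⟩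
    c * δ a b + δ a b                    ≡⟨ ring c (δ a b) ⟩
    (+ 1 + c) * δ a b                    ≡⟨ cong ((+ 1 + c) *_) (δ-↑ˡ n a b) ⟨
    (+ 1 + c) * δ (a ↑ˡ n) (b ↑ˡ n)      ∎
    where
    ring : ∀ c d → c * d + d ≡ (+ 1 + c) * d
    ring = solve-∀

  ⋉K₂-square-↑ˡ↑ʳ : ∀ a b → sum (λ l → B (a ↑ˡ n) l * B l (n ↑ʳ b)) ≡ (+ 1 + c) * δ (a ↑ˡ n) (n ↑ʳ b)
  ⋉K₂-square-↑ˡ↑ʳ a b = begin
    sum (λ l → B (a ↑ˡ n) l * B l (n ↑ʳ b))
      ≡⟨ sum-↑ n n _ ⟩
    sum (λ l → B (a ↑ˡ n) (l ↑ˡ n) * B (l ↑ˡ n) (n ↑ʳ b)) + sum (λ l → B (a ↑ˡ n) (n ↑ʳ l) * B (n ↑ʳ l) (n ↑ʳ b))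
      ≡⟨ cong₂ _+_ (trans (sum-cong-≗ λ l → cong₂ _*_ (⋉K₂-↑ˡ↑ˡ A a l) (⋉K₂-↑ˡ↑ʳ A l b)) (sum-δʳ b (A a)))
                   (trans (sum-cong-≗ λ l → cong₂ _*_ (⋉K₂-↑ˡ↑ʳ A a l) (⋉K₂-↑ʳ↑ʳ A l b)) (sum-δˡ a (λ l → - A l b))) ⟩
    A a b - A a b                        ≡⟨ ℤP.+-inverseʳ (A a b) ⟩
    + 0                                  ≡⟨ ℤP.*-zeroʳ (+ 1 + c) ⟨
    (+ 1 + c) * + 0                      ≡⟨ cong ((+ 1 + c) *_) (δ-↑ˡ-↑ʳ a b) ⟨
    (+ 1 + c) * δ (a ↑ˡ n) (n ↑ʳ b)      ∎

  ⋉K₂-square-↑ʳ↑ˡ : ∀ a b → sum (λ l → B (n ↑ʳ a) l * B l (b ↑ˡ n)) ≡ (+ 1 + c) * δ (n ↑ʳ a) (b ↑ˡ n)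
  ⋉K₂-square-↑ʳ↑ˡ a b = begin
    sum (λ l → B (n ↑ʳ a) l * B l (b ↑ˡ n))
      ≡⟨ sum-↑ n n _ ⟩
    sum (λ l → B (n ↑ʳ a) (l ↑ˡ n) * B (l ↑ˡ n) (b ↑ˡ n)) + sum (λ l → B (n ↑ʳ a) (n ↑ʳ l) * B (n ↑ʳ l) (b ↑ˡ n))
      ≡⟨ cong₂ _+_ (trans (sum-cong-≗ λ l → cong₂ _*_ (⋉K₂-↑ʳ↑ˡ A a l) (⋉K₂-↑ˡ↑ˡ A l b)) (sum-δˡ a (λ l → A l b)))
                   (trans (sum-cong-≗ λ l → cong₂ _*_ (⋉K₂-↑ʳ↑ʳ A a l) (⋉K₂-↑ʳ↑ˡ A l b)) (sum-δʳ b (λ l → - A a l))) ⟩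
    A a b - A a b                        ≡⟨ ℤP.+-inverseʳ (A a b) ⟩
    + 0                                  ≡⟨ ℤP.*-zeroʳ (+ 1 + c) ⟨
    (+ 1 + c) * + 0                      ≡⟨ cong ((+ 1 + c) *_) (δ-↑ʳ-↑ˡ a b) ⟨
    (+ 1 + c) * δ (n ↑ʳ a) (b ↑ˡ n)      ∎

  ⋉K₂-square-↑ʳ↑ʳ : ∀ a b → sum (λ l → B (n ↑ʳ a) l * B l (n ↑ʳ b)) ≡ (+ 1 + c) * δ (n ↑ʳ a) (n ↑ʳ b)
  ⋉K₂-square-↑ʳ↑ʳ a b = begin
    sum (λ l → B (n ↑ʳ a) l * B l (n ↑ʳ b))
      ≡⟨ sum-↑ n n _ ⟩
    sum (λ l → B (n ↑ʳ a) (l ↑ˡ n) * B (l ↑ˡ n) (n ↑ʳ b)) + sum (λ l → B (n ↑ʳ a) (n ↑ʳ l) * B (n ↑ʳ l) (n ↑ʳ b))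
      ≡⟨ cong₂ _+_ (trans (sum-cong-≗ λ l → cong₂ _*_ (⋉K₂-↑ʳ↑ˡ A a l) (⋉K₂-↑ˡ↑ʳ A l b)) (sum-δˡ a (λ l → δ l b)))
                   (trans (sum-cong-≗ λ l → trans (cong₂ _*_ (⋉K₂-↑ʳ↑ʳ A a l) (⋉K₂-↑ʳ↑ʳ A l b)) (neg*neg (A a l) (A l b))) (A²≡cI a b)) ⟩
    δ a b + c * δ a b                    ≡⟨ ring c (δ a b) ⟩
    (+ 1 + c) * δ a b                    ≡⟨ cong ((+ 1 + c) *_) (δ-↑ʳ n a b) ⟨
    (+ 1 + c) * δ (n ↑ʳ a) (n ↑ʳ b)      ∎
    where
    ring : ∀ c d → d + c * d ≡ (+ 1 + c) * d
    ring = solve-∀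
    neg*neg : ∀ u v → - u * - v ≡ u * v
    neg*neg = solve-∀

  ⋉K₂-square : SquareIsScalar (⋉K₂ A) (+ 1 + c)
  ⋉K₂-square i j with ↑-view n n i | ↑-view n n j
  ... | left a  | left b  = ⋉K₂-square-↑ˡ↑ˡ a b
  ... | left a  | right b = ⋉K₂-square-↑ˡ↑ʳ a b
  ... | right a | left b  = ⋉K₂-square-↑ʳ↑ˡ a b
  ... | right a | right b = ⋉K₂-square-↑ʳ↑ʳ a b

charMat-neg-product : ∀ {n} {A : Mat n} {c} → SquareIsScalar A c →
  ∀ x a b → sum (λ l → charMat (λ i j → - A i j) x a l * charMat A x l b) ≡ (x * x - c) * δ a b
charMat-neg-product {A = A} {c} A²≡cI x a b = begin
  sum (λ l → (δ a l * x - - A a l) * T l b)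
    ≡⟨ sum-cong-≗ (λ l → expand (δ a l) (δ l b) x (A a l) (A l b)) ⟩
  sum (λ l → δ a l * (x * T l b) + A a l * x * δ l b - A a l * A l b)
    ≡⟨ trans (∑-distrib-+ (λ l → δ a l * (x * T l b) + A a l * x * δ l b) (λ l → - (A a l * A l b)))
             (cong₂ _+_ (∑-distrib-+ (λ l → δ a l * (x * T l b)) (λ l → A a l * x * δ l b)) (sum-neg (λ l → A a l * A l b))) ⟩
  sum (λ l → δ a l * (x * T l b)) + sum (λ l → A a l * x * δ l b) - sum (λ l → A a l * A l b)
    ≡⟨ cong₂ _-_ (cong₂ _+_ (sum-δˡ a (λ l → x * T l b)) (sum-δʳ b (λ l → A a l * x))) (A²≡cI a b) ⟩
  x * T a b + A a b * x - c * δ a b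
    ≡⟨ collect (δ a b) x (A a b) c ⟩
  (x * x - c) * δ a b ∎
  where
  T = charMat A x
  expand : ∀ dal dlb x aal alb → (dal * x - - aal) * (dlb * x - alb) ≡
             dal * (x * (dlb * x - alb)) + aal * x * dlb - aal * alb
  expand = solve-∀
  collect : ∀ d x a c → x * (d * x - a) + a * x - c * d ≡ (x * x - c) * d
  collect = solve-∀

det-charMat-⋉K₂ : ∀ {n} {A : Mat n} {c} → SquareIsScalar A c →
                  ∀ x → det (charMat (⋉K₂ A) x) ≡ (x * x - (+ 1 + c)) ℤ.^ n
det-charMat-⋉K₂ {n} {A} {c} A²≡cI x = begin
  det X                        ≡⟨ BlockDeterminant.det-block (charMat A x) (charMat (λ i j → - A i j) x) (x * x - c)
                                    (charMat-neg-product A²≡cI x) X X-↑ˡ↑ˡ X-↑ˡ↑ʳ X-↑ʳ↑ˡ X-↑ʳ↑ʳ ⟩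
  (x * x - c - + 1) ℤ.^ n      ≡⟨ cong (ℤ._^ n) (ring (x * x) c) ⟩
  (x * x - (+ 1 + c)) ℤ.^ n    ∎
  where
  ring : ∀ y c → y - c - + 1 ≡ y - (+ 1 + c)
  ring = solve-∀
  X = charMat (⋉K₂ A) x
  zero-x : ∀ d → + 0 * x - d ≡ - d
  zero-x d = trans (cong (_- d) (ℤP.*-zeroˡ x)) (ℤP.+-identityˡ (- d))
  X-↑ˡ↑ˡ : ∀ a b → X (a ↑ˡ n) (b ↑ˡ n) ≡ charMat A x a b
  X-↑ˡ↑ˡ a b = cong₂ (λ d e → d * x - e) (δ-↑ˡ n a b) (⋉K₂-↑ˡ↑ˡ A a b)
  X-↑ˡ↑ʳ : ∀ a b → X (a ↑ˡ n) (n ↑ʳ b) ≡ - δ a b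
  X-↑ˡ↑ʳ a b = trans (cong₂ (λ d e → d * x - e) (δ-↑ˡ-↑ʳ a b) (⋉K₂-↑ˡ↑ʳ A a b)) (zero-x (δ a b))
  X-↑ʳ↑ˡ : ∀ a b → X (n ↑ʳ a) (b ↑ˡ n) ≡ - δ a b
  X-↑ʳ↑ˡ a b = trans (cong₂ (λ d e → d * x - e) (δ-↑ʳ-↑ˡ a b) (⋉K₂-↑ʳ↑ˡ A a b)) (zero-x (δ a b))
  X-↑ʳ↑ʳ : ∀ a b → X (n ↑ʳ a) (n ↑ʳ b) ≡ charMat (λ i j → - A i j) x a b
  X-↑ʳ↑ʳ a b = cong₂ (λ d e → d * x - e) (δ-↑ʳ n a b) (⋉K₂-↑ʳ↑ʳ A a b)

-- G ⋉ K₂ is again a signed rectagraph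

IsSignEntry : ℤ → Set
IsSignEntry x = x ≡ + 0 ⊎ x ≡ + 1 ⊎ x ≡ - + 1

δ-isSignEntry : ∀ {n} (a b : Fin n) → IsSignEntry (δ a b)
δ-isSignEntry a b with a FinP.≟ b
... | yes _ = inj₂ (inj₁ refl)
... | no  _ = inj₁ refl

neg-isSignEntry : ∀ {x} → IsSignEntry x → IsSignEntry (- x)
neg-isSignEntry (inj₁ refl)        = inj₁ refl
neg-isSignEntry (inj₂ (inj₁ refl)) = inj₂ (inj₂ refl)
neg-isSignEntry (inj₂ (inj₂ refl)) = inj₂ (inj₁ refl)

⋉K₂-isSignedGraph : ∀ {n} {A : Mat n} → IsSignedGraph A → IsSignedGraph (⋉K₂ A)
⋉K₂-isSignedGraph {n} {A} (symmetric , hollow , entries) = symmetric′ , hollow′ , entries′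
  where
  symmetric′ : ∀ i j → ⋉K₂ A i j ≡ ⋉K₂ A j i
  symmetric′ i j with ↑-view n n i | ↑-view n n j
  ... | left a  | left b  rewrite ⋉K₂-↑ˡ↑ˡ A a b | ⋉K₂-↑ˡ↑ˡ A b a = symmetric a b
  ... | left a  | right b rewrite ⋉K₂-↑ˡ↑ʳ A a b | ⋉K₂-↑ʳ↑ˡ A b a = δ-sym a b
  ... | right a | left b  rewrite ⋉K₂-↑ʳ↑ˡ A a b | ⋉K₂-↑ˡ↑ʳ A b a = δ-sym a b
  ... | right a | right b rewrite ⋉K₂-↑ʳ↑ʳ A a b | ⋉K₂-↑ʳ↑ʳ A b a = cong -_ (symmetric a b)
  hollow′ : ∀ i → ⋉K₂ A i i ≡ + 0
  hollow′ i with ↑-view n n i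
  ... | left a  rewrite ⋉K₂-↑ˡ↑ˡ A a a = hollow a
  ... | right a rewrite ⋉K₂-↑ʳ↑ʳ A a a = cong -_ (hollow a)
  entries′ : ∀ i j → IsSignEntry (⋉K₂ A i j)
  entries′ i j with ↑-view n n i | ↑-view n n j
  ... | left a  | left b  rewrite ⋉K₂-↑ˡ↑ˡ A a b = entries a b
  ... | left a  | right b rewrite ⋉K₂-↑ˡ↑ʳ A a b = δ-isSignEntry a b
  ... | right a | left b  rewrite ⋉K₂-↑ʳ↑ˡ A a b = δ-isSignEntry a b
  ... | right a | right b rewrite ⋉K₂-↑ʳ↑ʳ A a b = neg-isSignEntry (entries a b)

reach-trans : ∀ {n} {A : Mat n} {i j k} → Reach A i j → Reach A j k → Reach A i k
reach-trans here         j↝k = j↝k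
reach-trans (step i~l l↝j) j↝k = step i~l (reach-trans l↝j j↝k)

reach-map : ∀ {m n} {A : Mat m} {B : Mat n} (f : Fin m → Fin n) →
            (∀ {a b} → Adj A a b → Adj B (f a) (f b)) → ∀ {a b} → Reach A a b → Reach B (f a) (f b)
reach-map f f-adj here           = here
reach-map f f-adj (step a~c c↝b) = step (f-adj a~c) (reach-map f f-adj c↝b)

-x≢0 : ∀ {x} → x ≢ + 0 → - x ≢ + 0
-x≢0 {x} x≢0 -x≡0 = x≢0 (trans (sym (ℤP.neg-involutive x)) (cong -_ -x≡0))

module _ {n} (A : Mat n) {a b : Fin n} where
  ⋉K₂-adj-↑ˡ : Adj A a b → Adj (⋉K₂ A) (a ↑ˡ n) (b ↑ˡ n)
  ⋉K₂-adj-↑ˡ a~b = subst (_≢ + 0) (sym (⋉K₂-↑ˡ↑ˡ A a b)) a~b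

  ⋉K₂-adj-↑ʳ : Adj A a b → Adj (⋉K₂ A) (n ↑ʳ a) (n ↑ʳ b)
  ⋉K₂-adj-↑ʳ a~b = subst (_≢ + 0) (sym (⋉K₂-↑ʳ↑ʳ A a b)) (-x≢0 a~b)

  ⋉K₂-adj-↑ˡ⁻¹ : Adj (⋉K₂ A) (a ↑ˡ n) (b ↑ˡ n) → Adj A a b
  ⋉K₂-adj-↑ˡ⁻¹ a~b = subst (_≢ + 0) (⋉K₂-↑ˡ↑ˡ A a b) a~b

  ⋉K₂-adj-↑ʳ⁻¹ : Adj (⋉K₂ A) (n ↑ʳ a) (n ↑ʳ b) → Adj A a b
  ⋉K₂-adj-↑ʳ⁻¹ a~b = subst (_≢ + 0) (ℤP.neg-involutive (A a b)) (-x≢0 (subst (_≢ + 0) (⋉K₂-↑ʳ↑ʳ A a b) a~b))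

  ⋉K₂-adj-↑ˡ↑ʳ⁻¹ : Adj (⋉K₂ A) (a ↑ˡ n) (n ↑ʳ b) → a ≡ b
  ⋉K₂-adj-↑ˡ↑ʳ⁻¹ a~b with a FinP.≟ b
  ... | yes a≡b = a≡b
  ... | no  a≢b = ⊥-elim (a~b (trans (⋉K₂-↑ˡ↑ʳ A a b) (δ-≢ a≢b)))

  ⋉K₂-adj-↑ʳ↑ˡ⁻¹ : Adj (⋉K₂ A) (n ↑ʳ a) (b ↑ˡ n) → a ≡ b
  ⋉K₂-adj-↑ʳ↑ˡ⁻¹ a~b with a FinP.≟ b
  ... | yes a≡b = a≡b
  ... | no  a≢b = ⊥-elim (a~b (trans (⋉K₂-↑ʳ↑ˡ A a b) (δ-≢ a≢b)))

module _ {n} (A : Mat n) (a : Fin n) where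
  ⋉K₂-rung : Adj (⋉K₂ A) (a ↑ˡ n) (n ↑ʳ a)
  ⋉K₂-rung = subst (_≢ + 0) (sym (trans (⋉K₂-↑ˡ↑ʳ A a a) (δ-refl a))) λ ()

  ⋉K₂-rung′ : Adj (⋉K₂ A) (n ↑ʳ a) (a ↑ˡ n)
  ⋉K₂-rung′ = subst (_≢ + 0) (sym (trans (⋉K₂-↑ʳ↑ˡ A a a) (δ-refl a))) λ ()

⋉K₂-connected : ∀ {n} {A : Mat n} → Connected A → Connected (⋉K₂ A)
⋉K₂-connected {n} {A} connected i j = by-views (↑-view n n i) (↑-view n n j)
  where
  ↝ˡ : ∀ a b → Reach (⋉K₂ A) (a ↑ˡ n) (b ↑ˡ n)
  ↝ˡ a b = reach-map (_↑ˡ n) (⋉K₂-adj-↑ˡ A) (connected a b)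
  ↝ʳ : ∀ a b → Reach (⋉K₂ A) (n ↑ʳ a) (n ↑ʳ b)
  ↝ʳ a b = reach-map (n ↑ʳ_) (⋉K₂-adj-↑ʳ A) (connected a b)
  by-views : ∀ {i j} → ↑-View n n i → ↑-View n n j → Reach (⋉K₂ A) i j
  by-views (left a)  (left b)  = ↝ˡ a b
  by-views (left a)  (right b) = reach-trans (↝ˡ a b) (step (⋉K₂-rung A b) here)
  by-views (right a) (left b)  = reach-trans (↝ʳ a b) (step (⋉K₂-rung′ A b) here)
  by-views (right a) (right b) = ↝ʳ a b

⋉K₂-triangleFree : ∀ {n} {A : Mat n} → IsSignedGraph A → TriangleFree A → TriangleFree (⋉K₂ A)
⋉K₂-triangleFree {n} {A} isSigned triangleFree i j k (i~j , j~k , i~k) =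
  by-views (↑-view n n i) (↑-view n n j) (↑-view n n k) i~j j~k i~k
  where
  B = ⋉K₂ A
  sym-adj : ∀ {x y} → Adj B x y → Adj B y x
  sym-adj {x} {y} x~y = x~y ∘ trans (proj₁ (⋉K₂-isSignedGraph isSigned) x y)
  loopless : ∀ x → ¬ Adj B x x
  loopless x x~x = x~x (proj₁ (proj₂ (⋉K₂-isSignedGraph isSigned)) x)
  -- each vertex has exactly one neighbour on the other side
  two-left : ∀ a b c → Adj B (a ↑ˡ n) (b ↑ˡ n) → Adj B (a ↑ˡ n) (n ↑ʳ c) → Adj B (b ↑ˡ n) (n ↑ʳ c) → ⊥
  two-left a b c a~b a~c b~c with ⋉K₂-adj-↑ˡ↑ʳ⁻¹ A a~c | ⋉K₂-adj-↑ˡ↑ʳ⁻¹ A b~c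
  ... | refl | refl = loopless _ a~b
  two-right : ∀ a b c → Adj B (n ↑ʳ a) (n ↑ʳ b) → Adj B (n ↑ʳ a) (c ↑ˡ n) → Adj B (n ↑ʳ b) (c ↑ˡ n) → ⊥
  two-right a b c a~b a~c b~c with ⋉K₂-adj-↑ʳ↑ˡ⁻¹ A a~c | ⋉K₂-adj-↑ʳ↑ˡ⁻¹ A b~c
  ... | refl | refl = loopless _ a~b
  by-views : ∀ {i j k} → ↑-View n n i → ↑-View n n j → ↑-View n n k → Adj B i j → Adj B j k → Adj B i k → ⊥
  by-views (left a)  (left b)  (left c)  i~j j~k i~k =
    triangleFree a b c (⋉K₂-adj-↑ˡ⁻¹ A i~j , ⋉K₂-adj-↑ˡ⁻¹ A j~k , ⋉K₂-adj-↑ˡ⁻¹ A i~k)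
  by-views (right a) (right b) (right c) i~j j~k i~k =
    triangleFree a b c (⋉K₂-adj-↑ʳ⁻¹ A i~j , ⋉K₂-adj-↑ʳ⁻¹ A j~k , ⋉K₂-adj-↑ʳ⁻¹ A i~k)
  by-views (left a)  (left b)  (right c) i~j j~k i~k = two-left a b c i~j i~k j~k
  by-views (left a)  (right c) (left b)  i~j j~k i~k = two-left a b c i~k i~j (sym-adj j~k)
  by-views (right c) (left a)  (left b)  i~j j~k i~k = two-left a b c j~k (sym-adj i~j) (sym-adj i~k)
  by-views (right a) (right b) (left c)  i~j j~k i~k = two-right a b c i~j i~k j~k
  by-views (right a) (left c)  (right b) i~j j~k i~k = two-right a b c i~k i~j (sym-adj j~k)
  by-views (left c)  (right a) (right b) i~j j~k i~k = two-right a b c j~k (sym-adj i~j) (sym-adj i~k)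

indicator : Bool → ℕ
indicator true  = 1
indicator false = 0

count : ∀ {n} → (Fin n → Bool) → ℕ
count b = ℕSum.sum (indicator ∘ b)

count-cong : ∀ {n} {b b′ : Fin n → Bool} → (∀ k → b k ≡ b′ k) → count b ≡ count b′
count-cong b≗b′ = ℕSum.sum-cong-≗ (cong indicator ∘ b≗b′)

length-filter-tabulate : ∀ {a p} {A : Set a} {P : Pred A p} (P? : Decidable P) {n} (f : Fin n → A) →
                         length (filter P? (tabulate f)) ≡ count (λ k → does (P? (f k)))
length-filter-tabulate P? {zero}  f = refl
length-filter-tabulate P? {suc n} f with does (P? (f zero))
... | true  = cong suc (length-filter-tabulate P? (f ∘ suc))
... | false = length-filter-tabulate P? (f ∘ suc)

nonzero : ℤ → Bool
nonzero x = not (does (x ℤ.≟ + 0))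

nonzero-neg : ∀ x → nonzero (- x) ≡ nonzero x
nonzero-neg (+ zero)  = refl
nonzero-neg +[1+ n ] = refl
nonzero-neg -[1+ n ] = refl

nonzero-δ-≢ : ∀ {n} {a b : Fin n} → a ≢ b → nonzero (δ a b) ≡ false
nonzero-δ-≢ a≢b rewrite δ-≢ a≢b = refl

nonzero-δ-refl : ∀ {n} (a : Fin n) → nonzero (δ a a) ≡ true
nonzero-δ-refl a rewrite δ-refl a = refl

commonNbrs≡count : ∀ {n} (A : Mat n) i j → commonNbrs A i j ≡ count (λ k → nonzero (A i k) ∧ nonzero (A j k))
commonNbrs≡count {n} A i j = length-filter-tabulate (λ k → ¬? (A i k ℤ.≟ + 0) ×-dec ¬? (A j k ℤ.≟ + 0)) id

count-δˡ : ∀ {n} (a : Fin n) (g : Fin n → Bool) → count (λ l → nonzero (δ a l) ∧ g l) ≡ indicator (g a)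
count-δˡ a g = begin
  count (λ l → nonzero (δ a l) ∧ g l)   ≡⟨ ℕSum.sum-single _ a (λ l l≢a → cong (λ t → indicator (t ∧ g l)) (nonzero-δ-≢ (l≢a ∘ sym))) ⟩
  indicator (nonzero (δ a a) ∧ g a)     ≡⟨ cong (λ t → indicator (t ∧ g a)) (nonzero-δ-refl a) ⟩
  indicator (g a)                       ∎

count-δʳ : ∀ {n} (b : Fin n) (g : Fin n → Bool) → count (λ l → g l ∧ nonzero (δ b l)) ≡ indicator (g b)
count-δʳ b g = trans (count-cong λ l → BoolP.∧-comm (g l) _) (count-δˡ b g)

ZeroOrTwoCommonNbrs : ∀ {n} → Mat n → Set
ZeroOrTwoCommonNbrs A = ∀ i j → i ≢ j → commonNbrs A i j ≡ 0 ⊎ commonNbrs A i j ≡ 2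

module _ {n} (A : Mat n) where
  private
    B = ⋉K₂ A

    countOn : (Fin n → Fin (n ℕ.+ n)) → Fin (n ℕ.+ n) → Fin (n ℕ.+ n) → ℕ
    countOn f x y = count (λ l → nonzero (B x (f l)) ∧ nonzero (B y (f l)))

    split : ∀ x y → commonNbrs B x y ≡ countOn (_↑ˡ n) x y ℕ.+ countOn (n ↑ʳ_) x y
    split x y = trans (commonNbrs≡count B x y) (ℕSum.sum-↑ n n _)

    countOn-cong : ∀ f {x y} {u v : Fin n → ℤ} → (∀ l → B x (f l) ≡ u l) → (∀ l → B y (f l) ≡ v l) →
                   countOn f x y ≡ count (λ l → nonzero (u l) ∧ nonzero (v l))
    countOn-cong f x≗u y≗v = count-cong λ l → cong₂ (λ s t → nonzero s ∧ nonzero t) (x≗u l) (y≗v l)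

  ⋉K₂-commonNbrs-↑ˡ↑ˡ : ∀ {a b} → a ≢ b → commonNbrs B (a ↑ˡ n) (b ↑ˡ n) ≡ commonNbrs A a b
  ⋉K₂-commonNbrs-↑ˡ↑ˡ {a} {b} a≢b = begin
    commonNbrs B (a ↑ˡ n) (b ↑ˡ n)
      ≡⟨ split (a ↑ˡ n) (b ↑ˡ n) ⟩
    countOn (_↑ˡ n) (a ↑ˡ n) (b ↑ˡ n) ℕ.+ countOn (n ↑ʳ_) (a ↑ˡ n) (b ↑ˡ n)
      ≡⟨ cong₂ ℕ._+_ (countOn-cong (_↑ˡ n) (⋉K₂-↑ˡ↑ˡ A a) (⋉K₂-↑ˡ↑ˡ A b))
                     (countOn-cong (n ↑ʳ_) (⋉K₂-↑ˡ↑ʳ A a) (⋉K₂-↑ˡ↑ʳ A b)) ⟩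
    count (λ l → nonzero (A a l) ∧ nonzero (A b l)) ℕ.+ count (λ l → nonzero (δ a l) ∧ nonzero (δ b l))
      ≡⟨ cong₂ ℕ._+_ (sym (commonNbrs≡count A a b)) (trans (count-δˡ a _) (cong indicator (nonzero-δ-≢ (a≢b ∘ sym)))) ⟩
    commonNbrs A a b ℕ.+ 0
      ≡⟨ ℕP.+-identityʳ _ ⟩
    commonNbrs A a b ∎

  ⋉K₂-commonNbrs-↑ʳ↑ʳ : ∀ {a b} → a ≢ b → commonNbrs B (n ↑ʳ a) (n ↑ʳ b) ≡ commonNbrs A a b
  ⋉K₂-commonNbrs-↑ʳ↑ʳ {a} {b} a≢b = begin
    commonNbrs B (n ↑ʳ a) (n ↑ʳ b)
      ≡⟨ split (n ↑ʳ a) (n ↑ʳ b) ⟩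
    countOn (_↑ˡ n) (n ↑ʳ a) (n ↑ʳ b) ℕ.+ countOn (n ↑ʳ_) (n ↑ʳ a) (n ↑ʳ b)
      ≡⟨ cong₂ ℕ._+_ (countOn-cong (_↑ˡ n) (⋉K₂-↑ʳ↑ˡ A a) (⋉K₂-↑ʳ↑ˡ A b))
                     (countOn-cong (n ↑ʳ_) (⋉K₂-↑ʳ↑ʳ A a) (⋉K₂-↑ʳ↑ʳ A b)) ⟩
    count (λ l → nonzero (δ a l) ∧ nonzero (δ b l)) ℕ.+ count (λ l → nonzero (- A a l) ∧ nonzero (- A b l))
      ≡⟨ cong₂ ℕ._+_ (trans (count-δˡ a _) (cong indicator (nonzero-δ-≢ (a≢b ∘ sym))))
                     (trans (count-cong λ l → cong₂ _∧_ (nonzero-neg (A a l)) (nonzero-neg (A b l))) (sym (commonNbrs≡count A a b))) ⟩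
    commonNbrs A a b ∎

  module _ (symmetric : ∀ a b → A a b ≡ A b a) (a b : Fin n) where
    ⋉K₂-commonNbrs-↑ˡ↑ʳ : commonNbrs B (a ↑ˡ n) (n ↑ʳ b) ≡ indicator (nonzero (A a b)) ℕ.+ indicator (nonzero (A a b))
    ⋉K₂-commonNbrs-↑ˡ↑ʳ = begin
      commonNbrs B (a ↑ˡ n) (n ↑ʳ b)
        ≡⟨ split (a ↑ˡ n) (n ↑ʳ b) ⟩
      countOn (_↑ˡ n) (a ↑ˡ n) (n ↑ʳ b) ℕ.+ countOn (n ↑ʳ_) (a ↑ˡ n) (n ↑ʳ b)
        ≡⟨ cong₂ ℕ._+_ (countOn-cong (_↑ˡ n) (⋉K₂-↑ˡ↑ˡ A a) (⋉K₂-↑ʳ↑ˡ A b))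
                       (countOn-cong (n ↑ʳ_) (⋉K₂-↑ˡ↑ʳ A a) (⋉K₂-↑ʳ↑ʳ A b)) ⟩
      count (λ l → nonzero (A a l) ∧ nonzero (δ b l)) ℕ.+ count (λ l → nonzero (δ a l) ∧ nonzero (- A b l))
        ≡⟨ cong₂ ℕ._+_ (count-δʳ b _) (trans (count-δˡ a _) (cong indicator (trans (nonzero-neg (A b a)) (cong nonzero (symmetric b a))))) ⟩
      indicator (nonzero (A a b)) ℕ.+ indicator (nonzero (A a b)) ∎

    ⋉K₂-commonNbrs-↑ʳ↑ˡ : commonNbrs B (n ↑ʳ a) (b ↑ˡ n) ≡ indicator (nonzero (A a b)) ℕ.+ indicator (nonzero (A a b))
    ⋉K₂-commonNbrs-↑ʳ↑ˡ = begin
      commonNbrs B (n ↑ʳ a) (b ↑ˡ n)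
        ≡⟨ split (n ↑ʳ a) (b ↑ˡ n) ⟩
      countOn (_↑ˡ n) (n ↑ʳ a) (b ↑ˡ n) ℕ.+ countOn (n ↑ʳ_) (n ↑ʳ a) (b ↑ˡ n)
        ≡⟨ cong₂ ℕ._+_ (countOn-cong (_↑ˡ n) (⋉K₂-↑ʳ↑ˡ A a) (⋉K₂-↑ˡ↑ˡ A b))
                       (countOn-cong (n ↑ʳ_) (⋉K₂-↑ʳ↑ʳ A a) (⋉K₂-↑ˡ↑ʳ A b)) ⟩
      count (λ l → nonzero (δ a l) ∧ nonzero (A b l)) ℕ.+ count (λ l → nonzero (- A a l) ∧ nonzero (δ b l))
        ≡⟨ cong₂ ℕ._+_ (trans (count-δˡ a _) (cong (indicator ∘ nonzero) (symmetric b a)))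
                       (trans (count-δʳ b _) (cong indicator (nonzero-neg (A a b)))) ⟩
      indicator (nonzero (A a b)) ℕ.+ indicator (nonzero (A a b)) ∎

⋉K₂-zeroOrTwoCommonNbrs : ∀ {n} {A : Mat n} → (∀ a b → A a b ≡ A b a) →
                          ZeroOrTwoCommonNbrs A → ZeroOrTwoCommonNbrs (⋉K₂ A)
⋉K₂-zeroOrTwoCommonNbrs {n} {A} symmetric zeroOrTwo i j = by-views (↑-view n n i) (↑-view n n j)
  where
  zeroOrTwo-≡ : ∀ {m m′} → m ≡ m′ → m′ ≡ 0 ⊎ m′ ≡ 2 → m ≡ 0 ⊎ m ≡ 2
  zeroOrTwo-≡ refl = id
  double : ∀ t → indicator t ℕ.+ indicator t ≡ 0 ⊎ indicator t ℕ.+ indicator t ≡ 2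
  double true  = inj₂ refl
  double false = inj₁ refl
  by-views : ∀ {i j} → ↑-View n n i → ↑-View n n j → i ≢ j →
             commonNbrs (⋉K₂ A) i j ≡ 0 ⊎ commonNbrs (⋉K₂ A) i j ≡ 2
  by-views (left a)  (left b)  i≢j = zeroOrTwo-≡ (⋉K₂-commonNbrs-↑ˡ↑ˡ A a≢b) (zeroOrTwo a b a≢b)
    where a≢b = i≢j ∘ cong (_↑ˡ n)
  by-views (right a) (right b) i≢j = zeroOrTwo-≡ (⋉K₂-commonNbrs-↑ʳ↑ʳ A a≢b) (zeroOrTwo a b a≢b)
    where a≢b = i≢j ∘ cong (n ↑ʳ_)
  by-views (left a)  (right b) _ = zeroOrTwo-≡ (⋉K₂-commonNbrs-↑ˡ↑ʳ A symmetric a b) (double (nonzero (A a b)))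
  by-views (right a) (left b)  _ = zeroOrTwo-≡ (⋉K₂-commonNbrs-↑ʳ↑ˡ A symmetric a b) (double (nonzero (A a b)))

⋉K₂-isSignedRectagraph : ∀ {n} {A : Mat n} → IsSignedRectagraph A → IsSignedRectagraph (⋉K₂ A)
⋉K₂-isSignedRectagraph ((isSigned , connected , zeroOrTwo) , triangleFree) =
  ( ⋉K₂-isSignedGraph isSigned
  , ⋉K₂-connected connected
  , ⋉K₂-zeroOrTwoCommonNbrs (proj₁ isSigned) zeroOrTwo)
  , ⋉K₂-triangleFree isSigned triangleFree

-- The graphs Ġ_r

K₂-isSignedRectagraph : IsSignedRectagraph K₂
K₂-isSignedRectagraph = ((symmetric , hollow , entries) , connected , zeroOrTwo) , triangleFree
  where
  symmetric : ∀ i j → K₂ i j ≡ K₂ j i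
  symmetric zero       zero       = refl
  symmetric zero       (suc zero) = refl
  symmetric (suc zero) zero       = refl
  symmetric (suc zero) (suc zero) = refl
  hollow : ∀ i → K₂ i i ≡ + 0
  hollow zero       = refl
  hollow (suc zero) = refl
  entries : ∀ i j → IsSignEntry (K₂ i j)
  entries zero       zero       = inj₁ refl
  entries zero       (suc zero) = inj₂ (inj₁ refl)
  entries (suc zero) zero       = inj₂ (inj₁ refl)
  entries (suc zero) (suc zero) = inj₁ refl
  connected : Connected K₂
  connected zero       zero       = here
  connected zero       (suc zero) = step (λ ()) here
  connected (suc zero) zero       = step (λ ()) here
  connected (suc zero) (suc zero) = here
  zeroOrTwo : ZeroOrTwoCommonNbrs K₂
  zeroOrTwo zero       zero       0≢0 = ⊥-elim (0≢0 refl)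
  zeroOrTwo zero       (suc zero) _   = inj₁ refl
  zeroOrTwo (suc zero) zero       _   = inj₁ refl
  zeroOrTwo (suc zero) (suc zero) 1≢1 = ⊥-elim (1≢1 refl)
  triangleFree : TriangleFree K₂
  triangleFree zero       zero       _          (i~j , _ , _) = i~j refl
  triangleFree (suc zero) (suc zero) _          (i~j , _ , _) = i~j refl
  triangleFree zero       (suc zero) zero       (_ , _ , i~k) = i~k refl
  triangleFree zero       (suc zero) (suc zero) (_ , j~k , _) = j~k refl
  triangleFree (suc zero) zero       zero       (_ , j~k , _) = j~k refl
  triangleFree (suc zero) zero       (suc zero) (_ , _ , i~k) = i~k refl

Gr-isSignedRectagraph : ∀ k → IsSignedRectagraph (Gr k)
Gr-isSignedRectagraph zero    = K₂-isSignedRectagraph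
Gr-isSignedRectagraph (suc k) = ⋉K₂-isSignedRectagraph (Gr-isSignedRectagraph k)

Gr-square : ∀ k → SquareIsScalar (Gr k) (+ suc k)
Gr-square zero zero       zero       = refl
Gr-square zero zero       (suc zero) = refl
Gr-square zero (suc zero) zero       = refl
Gr-square zero (suc zero) (suc zero) = refl
Gr-square (suc k) = ⋉K₂-square {c = + suc k} (Gr-square k)

det-charMat-K₂ : ∀ x → det (charMat K₂ x) ≡ (x * x - + 1) ℤ.^ 1
det-charMat-K₂ = ring
  where
  -- the left-hand side is the Laplace expansion of det (charMat K₂ x), unfolded
  ring : ∀ x → + 1 * ((+ 1 * x - + 0) * (+ 1 * ((+ 1 * x - + 0) * + 1) + + 0)) +
               (- + 1 * ((+ 0 * x - + 1) * (+ 1 * ((+ 0 * x - + 1) * + 1) + + 0)) + + 0)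
               ≡ (x * x - + 1) * + 1
  ring = solve-∀

0<size : ∀ k → 0 < size k
0<size zero    = s≤s z≤n
0<size (suc k) = ℕP.<-≤-trans (0<size k) (ℕP.m≤m+n (size k) (size k))

Gr-eigenvaluesExactlyPm√ : ∀ k → EigenvaluesExactlyPm√ (Gr k) (suc k)
Gr-eigenvaluesExactlyPm√ zero    = det[xI-A]≡[x²-c]^e⇒±√c K₂ 1 1 (s≤s z≤n) (det-charMat-K₂ ∘ +_)
Gr-eigenvaluesExactlyPm√ (suc k) = det[xI-A]≡[x²-c]^e⇒±√c (Gr (suc k)) (suc (suc k)) (size k) (0<size k) (det-charMat-⋉K₂ {c = + suc k} (Gr-square k) ∘ +_)

corollary3p10 : (k : ℕ) → IsSignedRectagraph (Gr k) × EigenvaluesExactlyPm√ (Gr k) (suc k)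
corollary3p10 k = Gr-isSignedRectagraph k , Gr-eigenvaluesExactlyPm√ k
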